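{- Consider an instance of the Maximum Coverage Problem with Knapsack Constraints and its linear relaxation (LP) as in the context, and let $(x^*,y^*)$ be an optimal solution of (LP). Then there exists a feasible solution $(x,y)$ of (LP) such that $x$ satisfies the bounded split property and $F(x)\ge F(x^*)$, where $F(x)=\sum_{i\in\mathcal{I}}p_i\big(1-\prod_{j\in\mathcal{S}(i)}(1-\sum_{k\in\mathcal{K}}x_{jk})\big)$.
   Context: Instance: items $\mathcal{I}=[n]$ with profits $p_i>0$; sets $S_1,\dots,S_m\subseteq\mathcal{I}$ (identified with $\mathcal{S}=[m]$) with costs $c_j>0$; knapsacks $\mathcal{K}=[p]$ with capacities $B_k>0$; $\mathcal{S}(i)=\{j: i\in S_j\}$. (LP): variables $x_{jk}$ for $j\in\mathcal{S}$, $k\in\mathcal{K}$ with $B_k\ge c_j$ (other $x_{jk}$ absent, i.e. $0$), and $y_i$, $i\in\mathcal{I}$; maximize $\sum_i p_iy_i$ subject to $\sum_j c_jx_{jk}\le B_k$ ($k\in\mathcal{K}$), $\sum_k x_{jk}\le1$ ($j\in\mathcal{S}$), $\sum_{j\in\mathcal{S}(i)}\sum_k x_{jk}\ge y_i$ ($i\in\mathcal{I}$), $x,y\in[0,1]$. The support graph of $x$ is the bipartite graph $H_x$ with node sets $\mathcal{S}$ and $\mathcal{K}$ and edge set $E_x=\{\{j,k\}: 0<x_{jk}<1\}$. A matching $M\subseteq E_x$ is $\mathcal{S}$-saturating if every non-isolated node $j\in\mathcal{S}$ of $H_x$ is covered by an edge of $M$. A feasible $x$ satisfies the bounded split property if $H_x$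 has an $\mathcal{S}$-saturating matching. The empty product equals $1$.
   Formalization: The profits $p_i$, costs $c_j$ and capacities $B_k$ are rational, and $(x^*,y^*)$ and $(x,y)$ take values in ℚ, with optimality of $(x^*,y^*)$ compared against rational feasible solutions. -}

module Defs where

open import Data.Nat using (ℕ; zero; suc)
open import Data.Fin using (Fin; zero; suc)
open import Data.Bool using (Bool; true; false; if_then_else_)
open import Data.Rational using (ℚ; 0ℚ; 1ℚ; _+_; _*_; _-_; _≤_; _<_)
open import Data.Product using (Σ; _×_; ∃; ∃-syntax)
open import Relation.Binary.PropositionalEquality using (_≡_)

∑ : (n : ℕ) → (Fin n → ℚ) → ℚ
∑ zero f = 0ℚ
∑ (suc n) f = f zero + ∑ n (λ i → f (suc i))

∏ : (n : ℕ) → (Fin n → ℚ) → ℚ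
∏ zero f = 1ℚ
∏ (suc n) f = f zero * ∏ n (λ i → f (suc i))

record Instance (n m p : ℕ) : Set where
  field
    profit : Fin n → ℚ
    cost   : Fin m → ℚ
    cap    : Fin p → ℚ
    -- inSet j i = true  iff  item i ∈ S_j
    inSet  : Fin m → Fin n → Bool
    profit-pos : ∀ i → 0ℚ < profit i
    cost-pos   : ∀ j → 0ℚ < cost j
    cap-pos    : ∀ k → 0ℚ < cap k

module _ {n m p : ℕ} (I : Instance n m p) where
  open Instance I

  load : (Fin m → Fin p → ℚ) → Fin m → ℚ
  load x j = ∑ p (λ k → x j k)

  -- (x , y) is a feasible solution of (LP).  Variables x_jk with B_k < c_j
  -- are absent, i.e. forced to 0.
  record Feasible (x : Fin m → Fin p → ℚ) (y : Fin n → ℚ) : Set where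
    field
      absent   : ∀ j k → cap k < cost j → x j k ≡ 0ℚ
      knapsack : ∀ k → ∑ m (λ j → cost j * x j k) ≤ cap k
      once     : ∀ j → load x j ≤ 1ℚ
      cover    : ∀ i → y i ≤ ∑ m (λ j → if inSet j i then load x j else 0ℚ)
      x-lo     : ∀ j k → 0ℚ ≤ x j k
      x-hi     : ∀ j k → x j k ≤ 1ℚ
      y-lo     : ∀ i → 0ℚ ≤ y i
      y-hi     : ∀ i → y i ≤ 1ℚ

  objective : (Fin n → ℚ) → ℚ
  objective y = ∑ n (λ i → profit i * y i)

  Optimal : (Fin m → Fin p → ℚ) → (Fin n → ℚ) → Set
  Optimal x y = Feasible x y ×
    (∀ x' y' → Feasible x' y' → objective y' ≤ objective y)

  F : (Fin m → Fin p → ℚ) → ℚ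
  F x = ∑ n (λ i → profit i *
          (1ℚ - ∏ m (λ j → if inSet j i then 1ℚ - load x j else 1ℚ)))

Edge : {m p : ℕ} → (Fin m → Fin p → ℚ) → Fin m → Fin p → Set
Edge x j k = (0ℚ < x j k) × (x j k < 1ℚ)

record IsMatching {m p : ℕ} (x : Fin m → Fin p → ℚ)
                  (M : Fin m → Fin p → Bool) : Set where
  field
    sub   : ∀ j k → M j k ≡ true → Edge x j k
    uniqS : ∀ j k k' → M j k ≡ true → M j k' ≡ true → k ≡ k'
    uniqK : ∀ j j' k → M j k ≡ true → M j' k ≡ true → j ≡ j'

Saturating : {m p : ℕ} → (Fin m → Fin p → ℚ) → (Fin m → Fin p → Bool) → Set
Saturating x M = ∀ j → (∃[ k ] Edge x j k) → ∃[ k ] (M j k ≡ true)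

BoundedSplit : {m p : ℕ} → (Fin m → Fin p → ℚ) → Set
BoundedSplit x = ∃[ M ] (IsMatching x M × Saturating x M)

-- F depends on x only through the loads L_j = ∑_k x_jk, and along a direction that
-- moves cost-weighted load from one set to another it is a convex quadratic (its curvature is a
-- product of nonnegative factors), so one of the two directions never decreases it.  Sort the sets
-- by decreasing cost and the knapsacks by decreasing capacity and work with the weights W_j = c_j L_j.
-- Set j fits only in the knapsacks with B_k ≥ c_j, a prefix of the sorted knapsacks, so the LP gives
-- the prefix bounds W_0 + ... + W_q ≤ D_q := ∑_{B_k ≥ c_q} B_k.  Pipage rounding, moving weight
-- between two fractional sets until one becomes integral or a prefix bound becomes tight, produces
-- weights in which any two fractional sets are separated by a tight prefix.  Laying the weights out
-- one after another along the sorted knapsacks gives a feasible x with these loads, and a tight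
-- prefix ends exactly on a knapsack boundary.  So each block between tight prefixes holds at most
-- one fractional set, and matching every split set to the knapsack where it starts (or, after the
-- fractional set of its block, where it ends) is an S-saturating matching.

module Submission where

open import Defs
open import Data.Nat as ℕ using (ℕ; zero; suc; s≤s)
import Data.Nat.Properties as ℕP
open import Data.Fin as Fin using (Fin; zero; suc; toℕ)
import Data.Fin.Properties as FinP
open import Data.Fin.Permutation as Perm using (Permutation; _⟨$⟩ʳ_; _⟨$⟩ˡ_)
open import Data.Bool using (Bool; true; false; if_then_else_)
open import Data.Rational
  using (ℚ; 0ℚ; 1ℚ; _+_; _*_; _-_; -_; _≤_; _<_; _⊓_; _⊔_; 1/_; positive; nonNegative)
open import Data.Rational.Properties
open import Data.Rational.Solver using (module +-*-Solver)
open import Data.Product using (Σ; _×_; _,_; proj₁; proj₂; ∃-syntax)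
open import Data.Sum as Sum using (_⊎_; inj₁; inj₂)
open import Data.Empty using (⊥; ⊥-elim)
open import Relation.Nullary using (¬_; Dec; yes; no; does)
open import Relation.Nullary.Decidable using (dec-true; dec-false; _×-dec_; _⊎-dec_; ¬?)
open import Relation.Binary.PropositionalEquality
open import Relation.Binary.Definitions using (tri<; tri≈; tri>)
import Algebra.Properties.Semiring.Sum as SemiringSum
open import Algebra.Bundles using (CommutativeRing)

open +-*-Solver

p≤q⇒0≤q-p : ∀ {p q} → p ≤ q → 0ℚ ≤ q - p
p≤q⇒0≤q-p {p} {q} p≤q = subst (_≤ q - p) (+-inverseʳ p) (+-monoˡ-≤ (- p) p≤q)

p<q⇒0<q-p : ∀ {p q} → p < q → 0ℚ < q - p
p<q⇒0<q-p {p} {q} p<q = subst (_< q - p) (+-inverseʳ p) (+-monoˡ-< (- p) p<q)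

q-p+p≡q : ∀ p q → (q - p) + p ≡ q
q-p+p≡q = solve 2 (λ p q → (q :- p) :+ p := q) refl

0≤q-p⇒p≤q : ∀ {p q} → 0ℚ ≤ q - p → p ≤ q
0≤q-p⇒p≤q {p} {q} h = subst₂ _≤_ (+-identityˡ p) (q-p+p≡q p q) (+-monoˡ-≤ p h)

≤-by-difference : ∀ {p q e} → q - p ≡ e → 0ℚ ≤ e → p ≤ q
≤-by-difference refl = 0≤q-p⇒p≤q

+-nonNeg : ∀ {p q} → 0ℚ ≤ p → 0ℚ ≤ q → 0ℚ ≤ p + q
+-nonNeg = +-mono-≤

*-nonNeg : ∀ {p q} → 0ℚ ≤ p → 0ℚ ≤ q → 0ℚ ≤ p * q
*-nonNeg {p} {q} 0≤p 0≤q =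
  nonNegative⁻¹ _ {{nonNeg*nonNeg⇒nonNeg p {{nonNegative 0≤p}} q {{nonNegative 0≤q}}}}

*-pos : ∀ {p q} → 0ℚ < p → 0ℚ < q → 0ℚ < p * q
*-pos {p} {q} 0<p 0<q = positive⁻¹ _ {{pos*pos⇒pos p {{positive 0<p}} q {{positive 0<q}}}}

p≤p+q : ∀ {p q} → 0ℚ ≤ q → p ≤ p + q
p≤p+q {p} 0≤q = subst (_≤ p + _) (+-identityʳ p) (+-monoʳ-≤ p 0≤q)

p<p+q : ∀ {p q} → 0ℚ < q → p < p + q
p<p+q {p} 0<q = subst (_< p + _) (+-identityʳ p) (+-monoʳ-< p 0<q)

0≤1 : 0ℚ ≤ 1ℚ
0≤1 = <⇒≤ (positive⁻¹ 1ℚ)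

≤⇒≡∨< : ∀ {p q} → p ≤ q → p ≡ q ⊎ p < q
≤⇒≡∨< {p} {q} p≤q with <-cmp p q
... | tri< p<q _ _ = inj₂ p<q
... | tri≈ _ p≡q _ = inj₁ p≡q
... | tri> _ _ q<p = ⊥-elim (<-irrefl refl (≤-<-trans p≤q q<p))

<-≤-contradiction : ∀ {p q} → p < q → q ≤ p → ⊥
<-≤-contradiction p<q q≤p = <-irrefl refl (<-≤-trans p<q q≤p)

p+q≤r⇐q≤r-p : ∀ {p q r} → q ≤ r - p → p + q ≤ r
p+q≤r⇐q≤r-p {p} {q} {r} q≤r-p = subst (p + q ≤_) (solve 2 (λ p r → p :+ (r :- p) := r) refl p r) (+-monoʳ-≤ p q≤r-p)

p-q≤p : ∀ {p q} → 0ℚ ≤ q → p - q ≤ p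
p-q≤p {p} {q} 0≤q = ≤-by-difference (solve 2 (λ p q → p :- (p :- q) := q) refl p q) 0≤q

⊓-pos : ∀ {p q} → 0ℚ < p → 0ℚ < q → 0ℚ < p ⊓ q
⊓-pos {p} {q} 0<p 0<q with ⊓-sel p q
... | inj₁ ≡p = subst (0ℚ <_) (sym ≡p) 0<p
... | inj₂ ≡q = subst (0ℚ <_) (sym ≡q) 0<q

p+[q-p]≡q : ∀ p q → p + (q - p) ≡ q
p+[q-p]≡q = solve 2 (λ p q → p :+ (q :- p) := q) refl

p-[-q]≡p+q : ∀ p q → p - (- q) ≡ p + q
p-[-q]≡p+q = solve 2 (λ p q → p :- (:- q) := p :+ q) refl

module _ {A : Set} (d : Dec A) {x y : ℚ} where

  if-yes : A → (if does d then x else y) ≡ x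
  if-yes a = cong (if_then x else y) (dec-true d a)

  if-no : ¬ A → (if does d then x else y) ≡ y
  if-no ¬a = cong (if_then x else y) (dec-false d ¬a)

indicator-mono : ∀ {A B : Set} (a? : Dec A) (b? : Dec B) {v} → 0ℚ ≤ v → (A → B) →
                 (if does a? then v else 0ℚ) ≤ (if does b? then v else 0ℚ)
indicator-mono (yes a) (no ¬b) 0≤v A⇒B = ⊥-elim (¬b (A⇒B a))
indicator-mono (yes _) (yes _) 0≤v A⇒B = ≤-refl
indicator-mono (no _)  (yes _) 0≤v A⇒B = 0≤v
indicator-mono (no _)  (no _)  0≤v A⇒B = ≤-refl

does-true⇒ : ∀ {A : Set} (a? : Dec A) → does a? ≡ true → A
does-true⇒ (yes a) _ = a

indicator-nonNeg : ∀ (b : Bool) {v} → 0ℚ ≤ v → 0ℚ ≤ (if b then v else 0ℚ)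
indicator-nonNeg true  0≤v = 0≤v
indicator-nonNeg false 0≤v = ≤-refl

indicator≤ : ∀ (b : Bool) {v} → 0ℚ ≤ v → (if b then v else 0ℚ) ≤ v
indicator≤ true  0≤v = ≤-refl
indicator≤ false 0≤v = 0≤v

inverse : ∀ q → 0ℚ < q → ℚ
inverse q 0<q = (1/ q) {{pos⇒nonZero q {{positive 0<q}}}}

0<inverse : ∀ {q} (0<q : 0ℚ < q) → 0ℚ < inverse q 0<q
0<inverse {q} 0<q = positive⁻¹ _ {{1/pos⇒pos q {{positive 0<q}}}}

*-inverse : ∀ {q} (0<q : 0ℚ < q) → q * inverse q 0<q ≡ 1ℚ
*-inverse {q} 0<q = *-inverseʳ q {{pos⇒nonZero q {{positive 0<q}}}}

≤⇒*inverse≤1 : ∀ {p q} (0<q : 0ℚ < q) → p ≤ q → p * inverse q 0<q ≤ 1ℚ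
≤⇒*inverse≤1 {p} {q} 0<q p≤q =
  subst (p * inverse q 0<q ≤_) (*-inverse 0<q) (*-monoʳ-≤-nonNeg (inverse q 0<q) {{nonNegative (<⇒≤ (0<inverse 0<q))}} p≤q)

module ∑ℚ = SemiringSum (CommutativeRing.semiring +-*-commutativeRing)

∑≡sum : ∀ n (f : Fin n → ℚ) → ∑ n f ≡ ∑ℚ.sum f
∑≡sum zero f = refl
∑≡sum (suc n) f = cong (f zero +_) (∑≡sum n (λ i → f (suc i)))

∑-cong : ∀ n {f g : Fin n → ℚ} → (∀ i → f i ≡ g i) → ∑ n f ≡ ∑ n g
∑-cong zero f≗g = refl
∑-cong (suc n) f≗g = cong₂ _+_ (f≗g zero) (∑-cong n (λ i → f≗g (suc i)))

∏-cong : ∀ n {f g : Fin n → ℚ} → (∀ i → f i ≡ g i) → ∏ n f ≡ ∏ n g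
∏-cong zero f≗g = refl
∏-cong (suc n) f≗g = cong₂ _*_ (f≗g zero) (∏-cong n (λ i → f≗g (suc i)))

∑-distrib-+ : ∀ n (f g : Fin n → ℚ) → ∑ n (λ i → f i + g i) ≡ ∑ n f + ∑ n g
∑-distrib-+ n f g = begin
  ∑ n (λ i → f i + g i)     ≡⟨ ∑≡sum n _ ⟩
  ∑ℚ.sum (λ i → f i + g i)  ≡⟨ ∑ℚ.∑-distrib-+ f g ⟩
  ∑ℚ.sum f + ∑ℚ.sum g       ≡⟨ sym (cong₂ _+_ (∑≡sum n f) (∑≡sum n g)) ⟩
  ∑ n f + ∑ n g             ∎
  where open ≡-Reasoning

*-distribˡ-∑ : ∀ n a (f : Fin n → ℚ) → ∑ n (λ i → a * f i) ≡ a * ∑ n f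
*-distribˡ-∑ n a f = begin
  ∑ n (λ i → a * f i)     ≡⟨ ∑≡sum n _ ⟩
  ∑ℚ.sum (λ i → a * f i)  ≡⟨ sym (∑ℚ.*-distribˡ-sum a f) ⟩
  a * ∑ℚ.sum f            ≡⟨ sym (cong (a *_) (∑≡sum n f)) ⟩
  a * ∑ n f               ∎
  where open ≡-Reasoning

∑-comm : ∀ n k (f : Fin n → Fin k → ℚ) →
         ∑ n (λ i → ∑ k (f i)) ≡ ∑ k (λ j → ∑ n (λ i → f i j))
∑-comm n k f = begin
  ∑ n (λ i → ∑ k (f i))                    ≡⟨ ∑≡sum n _ ⟩
  ∑ℚ.sum (λ i → ∑ k (f i))                 ≡⟨ ∑ℚ.sum-cong-≗ (λ i → ∑≡sum k (f i)) ⟩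
  ∑ℚ.sum (λ i → ∑ℚ.sum (f i))              ≡⟨ ∑ℚ.∑-comm f ⟩
  ∑ℚ.sum (λ j → ∑ℚ.sum (λ i → f i j))      ≡⟨ sym (∑ℚ.sum-cong-≗ (λ j → ∑≡sum n (λ i → f i j))) ⟩
  ∑ℚ.sum (λ j → ∑ n (λ i → f i j))         ≡⟨ sym (∑≡sum k _) ⟩
  ∑ k (λ j → ∑ n (λ i → f i j))            ∎
  where open ≡-Reasoning

∑-permute : ∀ n (f : Fin n → ℚ) (π : Permutation n n) → ∑ n f ≡ ∑ n (λ i → f (π ⟨$⟩ʳ i))
∑-permute n f π = trans (∑≡sum n f) (trans (∑ℚ.∑-permute f π) (sym (∑≡sum n _)))

∑-distrib-- : ∀ n (f g : Fin n → ℚ) → ∑ n (λ i → f i - g i) ≡ ∑ n f - ∑ n g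
∑-distrib-- zero    f g = sym (+-inverseʳ 0ℚ)
∑-distrib-- (suc n) f g = trans (cong (f zero - g zero +_) (∑-distrib-- n (λ i → f (suc i)) (λ i → g (suc i))))
  (solve 4 (λ a b c d → (a :- b) :+ (c :- d) := (a :+ c) :- (b :+ d)) refl
           (f zero) (g zero) (∑ n (λ i → f (suc i))) (∑ n (λ i → g (suc i))))

∑-zero : ∀ n → ∑ n (λ _ → 0ℚ) ≡ 0ℚ
∑-zero zero = refl
∑-zero (suc n) = trans (+-identityˡ _) (∑-zero n)

∑-mono-≤ : ∀ n {f g : Fin n → ℚ} → (∀ i → f i ≤ g i) → ∑ n f ≤ ∑ n g
∑-mono-≤ zero f≤g = ≤-refl
∑-mono-≤ (suc n) f≤g = +-mono-≤ (f≤g zero) (∑-mono-≤ n (λ i → f≤g (suc i)))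

∑-nonNeg : ∀ n {f : Fin n → ℚ} → (∀ i → 0ℚ ≤ f i) → 0ℚ ≤ ∑ n f
∑-nonNeg n {f} 0≤f = subst (_≤ ∑ n f) (∑-zero n) (∑-mono-≤ n 0≤f)

if-∑ : ∀ n (b : Bool) (g : Fin n → ℚ) → (if b then ∑ n g else 0ℚ) ≡ ∑ n (λ k → if b then g k else 0ℚ)
if-∑ n true  g = refl
if-∑ n false g = sym (∑-zero n)

∏-nonNeg : ∀ n {f : Fin n → ℚ} → (∀ i → 0ℚ ≤ f i) → 0ℚ ≤ ∏ n f
∏-nonNeg zero 0≤f = 0≤1
∏-nonNeg (suc n) 0≤f = *-nonNeg (0≤f zero) (∏-nonNeg n (λ i → 0≤f (suc i)))

point : ∀ {n} → Fin n → ℚ → Fin n → ℚ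
point a v i = if does (i FinP.≟ a) then v else 0ℚ

∑-point : ∀ n (a : Fin n) v → ∑ n (point a v) ≡ v
∑-point (suc n) zero v = begin
  v + ∑ n (λ i → point zero v (suc i))  ≡⟨ cong (v +_) (∑-zero n) ⟩
  v + 0ℚ                                ≡⟨ +-identityʳ v ⟩
  v                                     ∎
  where open ≡-Reasoning
∑-point (suc n) (suc a) v = trans (+-identityˡ _) (trans (∑-cong n shift) (∑-point n a v))
  where
  shift : ∀ i → point (suc a) v (suc i) ≡ point a v i
  shift i with i FinP.≟ a
  ... | yes _ = refl
  ... | no _  = refl

setAt1 : ∀ {n} → (Fin n → ℚ) → Fin n → Fin n → ℚ
setAt1 g a i = if does (i FinP.≟ a) then 1ℚ else g i

∏-extract : ∀ n (g : Fin n → ℚ) a → ∏ n g ≡ g a * ∏ n (setAt1 g a)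
∏-extract (suc n) g zero = cong (g zero *_) (sym (trans (*-identityˡ _) (∏-cong n (λ _ → refl))))
∏-extract (suc n) g (suc a) = begin
  g zero * ∏ n (λ i → g (suc i))
    ≡⟨ cong (g zero *_) (∏-extract n (λ i → g (suc i)) a) ⟩
  g zero * (g (suc a) * ∏ n (setAt1 (λ i → g (suc i)) a))
    ≡⟨ cong (λ r → g zero * (g (suc a) * r)) (∏-cong n shift) ⟩
  g zero * (g (suc a) * ∏ n (λ i → setAt1 g (suc a) (suc i)))
    ≡⟨ solve 3 (λ x y z → x :* (y :* z) := y :* (x :* z)) refl (g zero) (g (suc a)) _ ⟩
  g (suc a) * (g zero * ∏ n (λ i → setAt1 g (suc a) (suc i)))
    ∎
  where
  open ≡-Reasoning
  shift : ∀ i → setAt1 (λ i → g (suc i)) a i ≡ setAt1 g (suc a) (suc i)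
  shift i with i FinP.≟ a
  ... | yes _ = refl
  ... | no _  = refl

∏-extract₂ : ∀ n (g : Fin n → ℚ) {a b} → a ≢ b → ∏ n g ≡ g a * (g b * ∏ n (setAt1 (setAt1 g a) b))
∏-extract₂ n g {a} {b} a≢b = trans (∏-extract n g a)
  (cong (g a *_) (trans (∏-extract n (setAt1 g a) b) (cong (_* ∏ n (setAt1 (setAt1 g a) b)) gb)))
  where
  gb : setAt1 g a b ≡ g b
  gb with b FinP.≟ a
  ... | yes b≡a = ⊥-elim (a≢b (sym b≡a))
  ... | no _    = refl

-- Consecutive layouts: items of widths w placed one after another from u; item j occupies [start u w j , end u w j].

start : ∀ {n} → ℚ → (Fin n → ℚ) → Fin n → ℚ
start u w zero    = u
start u w (suc j) = start (u + w zero) (λ i → w (suc i)) j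

end : ∀ {n} → ℚ → (Fin n → ℚ) → Fin n → ℚ
end u w j = start u w j + w j

total : ∀ n → ℚ → (Fin n → ℚ) → ℚ
total zero    u w = u
total (suc n) u w = total n (u + w zero) (λ i → w (suc i))

NonNeg : ∀ {n} → (Fin n → ℚ) → Set
NonNeg w = ∀ i → 0ℚ ≤ w i

start-as-∑ : ∀ {n} u (w : Fin n → ℚ) j →
             start u w j ≡ u + ∑ n (λ i → if does (i FinP.<? j) then w i else 0ℚ)
start-as-∑ {suc n} u w zero    = sym (trans (cong (u +_) (+-identityˡ _)) (trans (cong (u +_) (∑-zero n)) (+-identityʳ u)))
start-as-∑ {suc n} u w (suc j) = trans (start-as-∑ (u + w zero) _ j) (+-assoc u (w zero) _)

end-as-∑ : ∀ {n} u (w : Fin n → ℚ) j →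
           end u w j ≡ u + ∑ n (λ i → if does (i FinP.<? suc j) then w i else 0ℚ)
end-as-∑ {suc n} u w zero    = cong (u +_) (sym (trans (cong (w zero +_) (∑-zero n)) (+-identityʳ _)))
end-as-∑ {suc n} u w (suc j) = trans (end-as-∑ (u + w zero) _ j) (+-assoc u (w zero) _)

total-as-∑ : ∀ n u (w : Fin n → ℚ) → total n u w ≡ u + ∑ n w
total-as-∑ zero    u w = sym (+-identityʳ u)
total-as-∑ (suc n) u w = trans (total-as-∑ n (u + w zero) _) (+-assoc u (w zero) _)

NonNeg-suc : ∀ {n} {w : Fin (suc n) → ℚ} → NonNeg w → NonNeg (λ i → w (suc i))
NonNeg-suc 0≤w i = 0≤w (suc i)

u≤start : ∀ {n w} → NonNeg w → ∀ u (j : Fin n) → u ≤ start u w j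
u≤start 0≤w u zero    = ≤-refl
u≤start 0≤w u (suc j) = ≤-trans (p≤p+q (0≤w zero)) (u≤start (NonNeg-suc 0≤w) _ j)

u≤total : ∀ n {w} → NonNeg w → ∀ u → u ≤ total n u w
u≤total zero    0≤w u = ≤-refl
u≤total (suc n) 0≤w u = ≤-trans (p≤p+q (0≤w zero)) (u≤total n (NonNeg-suc 0≤w) _)

start≤end : ∀ {n w} → NonNeg w → ∀ u (j : Fin n) → start u w j ≤ end u w j
start≤end 0≤w u j = p≤p+q (0≤w j)

start<end : ∀ {n} {w : Fin n → ℚ} u j → 0ℚ < w j → start u w j < end u w j
start<end u j 0<wj = p<p+q 0<wj

end≤start : ∀ {n w} → NonNeg w → ∀ u {a b : Fin n} → a Fin.< b → end u w a ≤ start u w b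
end≤start 0≤w u {zero}  {suc b} _         = u≤start (NonNeg-suc 0≤w) _ b
end≤start 0≤w u {suc a} {suc b} (s≤s a<b) = end≤start (NonNeg-suc 0≤w) _ a<b

start-mono : ∀ {n w} → NonNeg w → ∀ u {a b : Fin n} → a Fin.≤ b → start u w a ≤ start u w b
start-mono 0≤w u {zero}  {b}     _         = u≤start 0≤w u b
start-mono 0≤w u {suc a} {suc b} (s≤s a≤b) = start-mono (NonNeg-suc 0≤w) _ a≤b

end-mono : ∀ {n w} → NonNeg w → ∀ u {a b : Fin n} → a Fin.≤ b → end u w a ≤ end u w b
end-mono 0≤w u {zero}  {zero}  _         = ≤-refl
end-mono 0≤w u {zero}  {suc b} _         = ≤-trans (u≤start (NonNeg-suc 0≤w) _ b) (start≤end (NonNeg-suc 0≤w) _ b)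
end-mono 0≤w u {suc a} {suc b} (s≤s a≤b) = end-mono (NonNeg-suc 0≤w) _ a≤b

∑-telescope : ∀ n (h : ℚ → ℚ) u (w : Fin n → ℚ) →
              ∑ n (λ j → h (end u w j) - h (start u w j)) ≡ h (total n u w) - h u
∑-telescope zero    h u w = sym (+-inverseʳ (h u))
∑-telescope (suc n) h u w = begin
  h u′ - h u + ∑ n (λ j → h (end u′ w′ j) - h (start u′ w′ j))
    ≡⟨ cong (h u′ - h u +_) (∑-telescope n h u′ w′) ⟩
  h u′ - h u + (h (total n u′ w′) - h u′)
    ≡⟨ solve 3 (λ a b c → (a :- b) :+ (c :- a) := c :- b) refl (h u′) (h u) (h (total n u′ w′)) ⟩
  h (total n u′ w′) - h u
    ∎
  where
  open ≡-Reasoning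
  u′ : ℚ
  u′ = u + w zero
  w′ : Fin n → ℚ
  w′ i = w (suc i)

locate-end : ∀ n u {w : Fin n → ℚ} → NonNeg w → ∀ {z} → u < z → z ≤ total n u w →
             ∃[ k ] (start u w k < z × z ≤ end u w k)
locate-end zero    u 0≤w u<z z≤u = ⊥-elim (<-≤-contradiction u<z z≤u)
locate-end (suc n) u {w} 0≤w {z} u<z z≤t with z ≤? u + w zero
... | yes z≤end = zero , u<z , z≤end
... | no z≰end with locate-end n (u + w zero) (NonNeg-suc 0≤w) (≰⇒> z≰end) z≤t
...   | k , in-k = suc k , in-k

locate-start : ∀ n u {w : Fin n → ℚ} → NonNeg w → ∀ {z} → u ≤ z → z < total n u w →
               ∃[ k ] (start u w k ≤ z × z < end u w k)
locate-start zero    u 0≤w u≤z z<u = ⊥-elim (<-≤-contradiction z<u u≤z)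
locate-start (suc n) u {w} 0≤w {z} u≤z z<t with z <? u + w zero
... | yes z<end = zero , u≤z , z<end
... | no z≮end with locate-start n (u + w zero) (NonNeg-suc 0≤w) (≮⇒≥ z≮end) z<t
...   | k , in-k = suc k , in-k

clamp : ℚ → ℚ → ℚ → ℚ
clamp z lo hi = (z ⊔ lo) ⊓ hi

lo≤clamp : ∀ z {lo hi} → lo ≤ hi → lo ≤ clamp z lo hi
lo≤clamp z lo≤hi = ⊓-glb (p≤q⊔p z _) lo≤hi

clamp≤hi : ∀ z lo hi → clamp z lo hi ≤ hi
clamp≤hi z lo hi = p⊓q≤q (z ⊔ lo) hi

clamp-mono : ∀ {z z′} lo hi → z ≤ z′ → clamp z lo hi ≤ clamp z′ lo hi
clamp-mono lo hi z≤z′ = ⊓-monoˡ-≤ hi (⊔-monoˡ-≤ lo z≤z′)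

clamp-inside : ∀ {z lo hi} → lo ≤ z → z ≤ hi → clamp z lo hi ≡ z
clamp-inside {z} {lo} {hi} lo≤z z≤hi = trans (cong (_⊓ hi) (p≥q⇒p⊔q≡p lo≤z)) (p≤q⇒p⊓q≡p z≤hi)

clamp-below : ∀ {z lo hi} → z ≤ lo → lo ≤ hi → clamp z lo hi ≡ lo
clamp-below {z} {lo} {hi} z≤lo lo≤hi = trans (cong (_⊓ hi) (p≤q⇒p⊔q≡q z≤lo)) (p≤q⇒p⊓q≡p lo≤hi)

clamp-above : ∀ {z lo hi} → hi ≤ z → lo ≤ hi → clamp z lo hi ≡ hi
clamp-above {z} {lo} {hi} hi≤z _ = p≥q⇒p⊓q≡q (≤-trans hi≤z (p≤p⊔q z lo))

clamp-split : ∀ z {u v t} → u ≤ v → v ≤ t → clamp z u v + clamp z v t ≡ clamp z u t + v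
clamp-split z {u} {v} {t} u≤v v≤t with ≤-total z v
... | inj₁ z≤v = begin
  (z ⊔ u) ⊓ v + (z ⊔ v) ⊓ t  ≡⟨ cong₂ _+_ (p≤q⇒p⊓q≡p z⊔u≤v)
                                           (trans (cong (_⊓ t) (p≤q⇒p⊔q≡q z≤v)) (p≤q⇒p⊓q≡p v≤t)) ⟩
  z ⊔ u + v                  ≡⟨ cong (_+ v) (sym (p≤q⇒p⊓q≡p (≤-trans z⊔u≤v v≤t))) ⟩
  (z ⊔ u) ⊓ t + v            ∎
  where
  open ≡-Reasoning
  z⊔u≤v : z ⊔ u ≤ v
  z⊔u≤v = ⊔-lub z≤v u≤v
... | inj₂ v≤z = begin
  (z ⊔ u) ⊓ v + (z ⊔ v) ⊓ t  ≡⟨ cong₂ _+_ (trans (cong (_⊓ v) (p≥q⇒p⊔q≡p u≤z)) (p≥q⇒p⊓q≡q v≤z))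
                                           (cong (_⊓ t) (p≥q⇒p⊔q≡p v≤z)) ⟩
  v + z ⊓ t                  ≡⟨ +-comm v _ ⟩
  z ⊓ t + v                  ≡⟨ cong (λ r → r ⊓ t + v) (sym (p≥q⇒p⊔q≡p u≤z)) ⟩
  (z ⊔ u) ⊓ t + v            ∎
  where
  open ≡-Reasoning
  u≤z : u ≤ z
  u≤z = ≤-trans u≤v v≤z

clamp-1-Lipschitz : ∀ {z z′} lo hi → z ≤ z′ → clamp z′ lo hi ≤ clamp z lo hi + (z′ - z)
clamp-1-Lipschitz {z} {z′} lo hi z≤z′ = ≤-trans (⊓-monoˡ-≤ hi z′⊔lo≤) (⊓-+-≤ (z ⊔ lo) hi)
  where
  d : ℚ
  d = z′ - z
  0≤d : 0ℚ ≤ d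
  0≤d = p≤q⇒0≤q-p z≤z′
  z′⊔lo≤ : z′ ⊔ lo ≤ z ⊔ lo + d
  z′⊔lo≤ = ⊔-lub (subst (_≤ z ⊔ lo + d) (solve 2 (λ z z′ → z :+ (z′ :- z) := z′) refl z z′)
                        (+-monoˡ-≤ d (p≤p⊔q z lo)))
                 (≤-trans (p≤q⊔p z lo) (p≤p+q 0≤d))
  ⊓-+-≤ : ∀ a hi → (a + d) ⊓ hi ≤ a ⊓ hi + d
  ⊓-+-≤ a hi with ≤-total a hi
  ... | inj₁ a≤hi = ≤-trans (p⊓q≤p (a + d) hi) (≤-reflexive (cong (_+ d) (sym (p≤q⇒p⊓q≡p a≤hi))))
  ... | inj₂ hi≤a = ≤-trans (p⊓q≤q (a + d) hi)
                      (≤-trans (p≤p+q 0≤d) (≤-reflexive (cong (_+ d) (sym (p≥q⇒p⊓q≡q hi≤a)))))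

∑-clamp-layout : ∀ n u {B : Fin n → ℚ} → NonNeg B → ∀ z →
                 ∑ n (λ k → clamp z (start u B k) (end u B k) - start u B k) ≡ clamp z u (total n u B) - u
∑-clamp-layout zero u 0≤B z = sym (trans (cong (_- u) (p≥q⇒p⊓q≡q (p≤q⊔p z u))) (+-inverseʳ u))
∑-clamp-layout (suc n) u {B} 0≤B z = begin
  clamp z u u′ - u + ∑ n (λ k → clamp z (start u′ B′ k) (end u′ B′ k) - start u′ B′ k)
    ≡⟨ cong (clamp z u u′ - u +_) (∑-clamp-layout n u′ (NonNeg-suc 0≤B) z) ⟩
  clamp z u u′ - u + (clamp z u′ t - u′)
    ≡⟨ solve 4 (λ a b u u′ → (a :- u) :+ (b :- u′) := (a :+ b) :- u′ :- u) refl (clamp z u u′) (clamp z u′ t) u u′ ⟩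
  clamp z u u′ + clamp z u′ t - u′ - u
    ≡⟨ cong (λ r → r - u′ - u) (clamp-split z (p≤p+q (0≤B zero)) (u≤total n (NonNeg-suc 0≤B) u′)) ⟩
  clamp z u t + u′ - u′ - u
    ≡⟨ solve 3 (λ a u u′ → (a :+ u′) :- u′ :- u := a :- u) refl (clamp z u t) u u′ ⟩
  clamp z u t - u
    ∎
  where
  open ≡-Reasoning
  u′ : ℚ
  u′ = u + B zero
  B′ : Fin n → ℚ
  B′ i = B (suc i)
  t : ℚ
  t = total n u′ B′

argmax : ∀ n (key : Fin (suc n) → ℚ) → Σ (Fin (suc n)) λ i → ∀ j → key j ≤ key i
argmax zero    key = zero , λ { zero → ≤-refl }
argmax (suc n) key with argmax n (λ j → key (suc j))
... | i , max with ≤-total (key zero) (key (suc i))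
...   | inj₁ k0≤ = suc i , λ { zero → k0≤    ; (suc j) → max j }
...   | inj₂ ≤k0 = zero  , λ { zero → ≤-refl ; (suc j) → ≤-trans (max j) ≤k0 }

SortedDescending : ∀ {n} → (Fin n → ℚ) → Permutation n n → Set
SortedDescending key π = ∀ {u v} → u Fin.≤ v → key (π ⟨$⟩ʳ v) ≤ key (π ⟨$⟩ʳ u)

sortDescending : ∀ n (key : Fin n → ℚ) → Σ (Permutation n n) (SortedDescending key)
sortDescending zero    key = Perm.id , λ { {()} }
sortDescending (suc n) key with argmax n key
... | i , max with sortDescending n (λ k → key (Fin.punchIn i k))
...   | π , sorted = Perm.insert zero i π , sorted′
  where
  sorted′ : SortedDescending key (Perm.insert zero i π)
  sorted′ {zero}  {v}     _         = max _
  sorted′ {suc u} {suc v} (s≤s u≤v)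
    rewrite Perm.insert-punchIn zero i π u | Perm.insert-punchIn zero i π v = sorted u≤v

-- Convexity of the coverage function along exchanges

module Coverage {n m p : ℕ} (I : Instance n m p) where
  open Instance I

  factor : Fin n → (Fin m → ℚ) → Fin m → ℚ
  factor i L j = if inSet j i then 1ℚ - L j else 1ℚ

  coverage : (Fin m → ℚ) → ℚ
  coverage L = ∑ n (λ i → profit i * (1ℚ - ∏ m (factor i L)))

  coverage-cong : ∀ {L L′} → (∀ j → L j ≡ L′ j) → coverage L ≡ coverage L′
  coverage-cong {L} {L′} L≗L′ = ∑-cong n (λ i → cong (λ r → profit i * (1ℚ - r)) (∏-cong m (factor-cong i)))
    where
    factor-cong : ∀ i j → factor i L j ≡ factor i L′ j
    factor-cong i j rewrite L≗L′ j = refl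

  module Exchange (L : Fin m → ℚ) (L≤1 : ∀ j → L j ≤ 1ℚ)
                  {a b : Fin m} (a≢b : a ≢ b) (d : Fin m → ℚ)
                  (0≤da : 0ℚ ≤ d a) (db≤0 : d b ≤ 0ℚ) (d-rest : ∀ j → j ≢ a → j ≢ b → d j ≡ 0ℚ) where

    shift : ℚ → Fin m → ℚ
    shift s j = L j + s * d j

    shift-zero : ∀ j → shift 0ℚ j ≡ L j
    shift-zero j = trans (cong (L j +_) (*-zeroˡ (d j))) (+-identityʳ (L j))

    rest : Fin n → ℚ → ℚ
    rest i s = ∏ m (setAt1 (setAt1 (factor i (shift s)) a) b)

    rest-const : ∀ i s → rest i s ≡ rest i 0ℚ
    rest-const i s = ∏-cong m same
      where
      same : ∀ j → setAt1 (setAt1 (factor i (shift s)) a) b j ≡ setAt1 (setAt1 (factor i (shift 0ℚ)) a) b j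
      same j with j FinP.≟ b
      ... | yes _ = refl
      ... | no j≢b with j FinP.≟ a
      ...   | yes _ = refl
      ...   | no j≢a rewrite d-rest j j≢a j≢b with inSet j i
      ...     | true  = cong (λ r → 1ℚ - (L j + r)) (trans (*-zeroʳ s) (sym (*-zeroʳ 0ℚ)))
      ...     | false = refl

    0≤rest : ∀ i → 0ℚ ≤ rest i 0ℚ
    0≤rest i = ∏-nonNeg m nonNeg
      where
      nonNeg : ∀ j → 0ℚ ≤ setAt1 (setAt1 (factor i (shift 0ℚ)) a) b j
      nonNeg j with does (j FinP.≟ b)
      ... | true  = 0≤1
      ... | false with does (j FinP.≟ a)
      ...   | true  = 0≤1
      ...   | false with inSet j i
      ...     | true  = p≤q⇒0≤q-p (subst (_≤ 1ℚ) (sym (shift-zero j)) (L≤1 j))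
      ...     | false = 0≤1

    rate : Fin m → Fin n → ℚ
    rate j i = if inSet j i then d j else 0ℚ

    factor-shift : ∀ i s j → factor i (shift s) j ≡ factor i L j - s * rate j i
    factor-shift i s j with inSet j i
    ... | true  = solve 3 (λ l s d → con 1ℚ :- (l :+ s :* d) := (con 1ℚ :- l) :- s :* d) refl (L j) s (d j)
    ... | false = solve 1 (λ s → con 1ℚ := con 1ℚ :- s :* con 0ℚ) refl s

    term : Fin n → ℚ → ℚ
    term i s = profit i * (1ℚ - ∏ m (factor i (shift s)))

    term-quadratic : ∀ i s → term i s ≡
      profit i * (1ℚ - (factor i L a - s * rate a i) * ((factor i L b - s * rate b i) * rest i 0ℚ))
    term-quadratic i s = cong (λ r → profit i * (1ℚ - r)) (begin
      ∏ m (factor i (shift s))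
        ≡⟨ ∏-extract₂ m _ a≢b ⟩
      factor i (shift s) a * (factor i (shift s) b * rest i s)
        ≡⟨ cong₂ (λ x y → x * (y * rest i s)) (factor-shift i s a) (factor-shift i s b) ⟩
      (factor i L a - s * rate a i) * ((factor i L b - s * rate b i) * rest i s)
        ≡⟨ cong (λ r → (factor i L a - s * rate a i) * ((factor i L b - s * rate b i) * r)) (rest-const i s) ⟩
      (factor i L a - s * rate a i) * ((factor i L b - s * rate b i) * rest i 0ℚ)
        ∎)
      where open ≡-Reasoning

    -- The convexity gap of T(s) = p (1 - (A - sσ)(B - sτ) R); it is nonnegative because σ ≥ 0 ≥ τ.
    convexity-gap : ∀ p R A B σ τ s t →
      t * (p * (1ℚ - (A - s * σ) * ((B - s * τ) * R))) + s * (p * (1ℚ - (A - (- t) * σ) * ((B - (- t) * τ) * R)))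
        - (s + t) * (p * (1ℚ - (A - 0ℚ * σ) * ((B - 0ℚ * τ) * R)))
      ≡ p * R * σ * (- τ) * s * t * (s + t)
    convexity-gap = solve 8 (λ p R A B σ τ s t →
      t :* (p :* (con 1ℚ :- (A :- s :* σ) :* ((B :- s :* τ) :* R)))
        :+ s :* (p :* (con 1ℚ :- (A :- (:- t) :* σ) :* ((B :- (:- t) :* τ) :* R)))
        :- (s :+ t) :* (p :* (con 1ℚ :- (A :- con 0ℚ :* σ) :* ((B :- con 0ℚ :* τ) :* R)))
      := p :* R :* σ :* (:- τ) :* s :* t :* (s :+ t)) refl

    term-convex : ∀ {s t} → 0ℚ ≤ s → 0ℚ ≤ t → ∀ i → (s + t) * term i 0ℚ ≤ t * term i s + s * term i (- t)
    term-convex {s} {t} 0≤s 0≤t i = ≤-by-difference gap 0≤excess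
      where
      excess : ℚ
      excess = profit i * rest i 0ℚ * rate a i * (- rate b i) * s * t * (s + t)
      gap : t * term i s + s * term i (- t) - (s + t) * term i 0ℚ ≡ excess
      gap = trans (cong₂ (λ x y → x - y) (cong₂ (λ x y → t * x + s * y) (term-quadratic i s) (term-quadratic i (- t)))
                                           (cong ((s + t) *_) (term-quadratic i 0ℚ)))
                  (convexity-gap (profit i) (rest i 0ℚ) (factor i L a) (factor i L b) (rate a i) (rate b i) s t)
      0≤rate-a : 0ℚ ≤ rate a i
      0≤rate-a with inSet a i
      ... | true  = 0≤da
      ... | false = ≤-refl
      0≤-rate-b : 0ℚ ≤ - rate b i
      0≤-rate-b with inSet b i
      ... | true  = neg-antimono-≤ db≤0
      ... | false = ≤-refl
      0≤excess : 0ℚ ≤ excess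
      0≤excess = *-nonNeg (*-nonNeg (*-nonNeg (*-nonNeg (*-nonNeg (*-nonNeg (<⇒≤ (profit-pos i)) (0≤rest i))
                   0≤rate-a) 0≤-rate-b) 0≤s) 0≤t) (+-nonNeg 0≤s 0≤t)

    coverage-convex : ∀ {s t} → 0ℚ ≤ s → 0ℚ ≤ t →
                      (s + t) * coverage L ≤ t * coverage (shift s) + s * coverage (shift (- t))
    coverage-convex {s} {t} 0≤s 0≤t = subst₂ _≤_
      (trans (*-distribˡ-∑ n (s + t) (λ i → term i 0ℚ)) (cong ((s + t) *_) (coverage-cong shift-zero)))
      (trans (∑-distrib-+ n _ _) (cong₂ _+_ (*-distribˡ-∑ n t (λ i → term i s)) (*-distribˡ-∑ n s (λ i → term i (- t)))))
      (∑-mono-≤ n (term-convex 0≤s 0≤t))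

    coverage-exchange : ∀ {s t} → 0ℚ < s → 0ℚ < t →
                        coverage L ≤ coverage (shift s) ⊎ coverage L ≤ coverage (shift (- t))
    coverage-exchange {s} {t} 0<s 0<t with coverage L ≤? coverage (shift s) | coverage L ≤? coverage (shift (- t))
    ... | yes up | _      = inj₁ up
    ... | no _   | yes dn = inj₂ dn
    ... | no up  | no dn  = ⊥-elim (<-≤-contradiction both (coverage-convex (<⇒≤ 0<s) (<⇒≤ 0<t)))
      where
      both : t * coverage (shift s) + s * coverage (shift (- t)) < (s + t) * coverage L
      both = subst (t * coverage (shift s) + s * coverage (shift (- t)) <_)
        (solve 3 (λ s t f → t :* f :+ s :* f := (s :+ t) :* f) refl s t (coverage L))
        (+-mono-< (*-monoʳ-<-pos t {{positive 0<t}} (≰⇒> up)) (*-monoʳ-<-pos s {{positive 0<s}} (≰⇒> dn)))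

-- Pipage rounding of weights under prefix capacity bounds

upTo : ∀ {n} → Fin n → (Fin n → ℚ) → Fin n → ℚ
upTo q w i = if does (i FinP.<? suc q) then w i else 0ℚ

exchange : ∀ {m} → Fin m → Fin m → Fin m → ℚ
exchange a b i = point a 1ℚ i + point b (- 1ℚ) i

transfer : ∀ {m} → (Fin m → ℚ) → Fin m → Fin m → ℚ → Fin m → ℚ
transfer W a b s i = W i + s * exchange a b i

module _ {m : ℕ} {a b : Fin m} (a≢b : a ≢ b) where

  exchange-at-a : exchange a b a ≡ 1ℚ
  exchange-at-a with a FinP.≟ a | a FinP.≟ b
  ... | no a≢a | _       = ⊥-elim (a≢a refl)
  ... | yes _  | yes a≡b = ⊥-elim (a≢b a≡b)
  ... | yes _  | no _    = +-identityʳ 1ℚ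

  exchange-at-b : exchange a b b ≡ - 1ℚ
  exchange-at-b with b FinP.≟ a | b FinP.≟ b
  ... | yes b≡a | _      = ⊥-elim (a≢b (sym b≡a))
  ... | no _    | no b≢b = ⊥-elim (b≢b refl)
  ... | no _    | yes _  = +-identityˡ (- 1ℚ)

  exchange-elsewhere : ∀ {i} → i ≢ a → i ≢ b → exchange a b i ≡ 0ℚ
  exchange-elsewhere {i} i≢a i≢b with i FinP.≟ a | i FinP.≟ b
  ... | yes i≡a | _       = ⊥-elim (i≢a i≡a)
  ... | no _    | yes i≡b = ⊥-elim (i≢b i≡b)
  ... | no _    | no _    = +-identityʳ 0ℚ

∑-upTo-point : ∀ {m} q (c : Fin m) v → ∑ m (upTo q (point c v)) ≡ upTo q (λ _ → v) c
∑-upTo-point {m} q c v = trans (∑-cong m restrict) (∑-point m c (upTo q (λ _ → v) c))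
  where
  restrict : ∀ i → upTo q (point c v) i ≡ point c (upTo q (λ _ → v) c) i
  restrict i with i FinP.≟ c
  ... | yes refl = refl
  ... | no _ with does (i FinP.<? suc q)
  ...   | true  = refl
  ...   | false = refl

module _ {m : ℕ} (W : Fin m → ℚ) {a b : Fin m} (a≢b : a ≢ b) (s : ℚ) where

  transfer-at-a : transfer W a b s a ≡ W a + s
  transfer-at-a = trans (cong (λ e → W a + s * e) (exchange-at-a a≢b)) (cong (W a +_) (*-identityʳ s))

  transfer-at-b : transfer W a b s b ≡ W b - s
  transfer-at-b = trans (cong (λ e → W b + s * e) (exchange-at-b a≢b))
                        (solve 2 (λ w s → w :+ s :* (:- con 1ℚ) := w :- s) refl (W b) s)

  transfer-elsewhere : ∀ {i} → i ≢ a → i ≢ b → transfer W a b s i ≡ W i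
  transfer-elsewhere {i} i≢a i≢b =
    trans (cong (λ e → W i + s * e) (exchange-elsewhere a≢b i≢a i≢b)) (trans (cong (W i +_) (*-zeroʳ s)) (+-identityʳ (W i)))

  crossing : Fin m → ℚ
  crossing q = upTo q (λ _ → 1ℚ) a + upTo q (λ _ → - 1ℚ) b

  end-transfer : ∀ q → end 0ℚ (transfer W a b s) q ≡ end 0ℚ W q + s * crossing q
  end-transfer q = begin
    end 0ℚ (transfer W a b s) q
      ≡⟨ end-as-∑ 0ℚ _ q ⟩
    0ℚ + ∑ m (upTo q (transfer W a b s))
      ≡⟨ cong (0ℚ +_) (∑-cong m linear) ⟩
    0ℚ + ∑ m (λ i → upTo q W i + s * (upTo q (point a 1ℚ) i + upTo q (point b (- 1ℚ)) i))
      ≡⟨ cong (0ℚ +_) (trans (∑-distrib-+ m _ _) (cong (∑ m (upTo q W) +_)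
           (trans (*-distribˡ-∑ m s _) (cong (s *_) (trans (∑-distrib-+ m _ _)
             (cong₂ _+_ (∑-upTo-point q a 1ℚ) (∑-upTo-point q b (- 1ℚ)))))))) ⟩
    0ℚ + (∑ m (upTo q W) + s * crossing q)
      ≡⟨ sym (+-assoc 0ℚ (∑ m (upTo q W)) (s * crossing q)) ⟩
    0ℚ + ∑ m (upTo q W) + s * crossing q
      ≡⟨ cong (_+ s * crossing q) (sym (end-as-∑ 0ℚ W q)) ⟩
    end 0ℚ W q + s * crossing q
      ∎
    where
    open ≡-Reasoning
    linear : ∀ i → upTo q (transfer W a b s) i ≡ upTo q W i + s * (upTo q (point a 1ℚ) i + upTo q (point b (- 1ℚ)) i)
    linear i with does (i FinP.<? suc q)
    ... | true  = refl
    ... | false = solve 1 (λ s → con 0ℚ := con 0ℚ :+ s :* (con 0ℚ :+ con 0ℚ)) refl s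

  crossing-inside : ∀ {q} → a Fin.≤ q → q Fin.< b → crossing q ≡ 1ℚ
  crossing-inside {q} a≤q q<b = trans (cong₂ _+_ (if-yes (a FinP.<? suc q) (s≤s a≤q)) (if-no (b FinP.<? suc q) b≮1+q))
                                      (+-identityʳ 1ℚ)
    where
    b≮1+q : ¬ b Fin.< suc q
    b≮1+q b<1+q = ℕP.<-irrefl refl (ℕP.<-≤-trans q<b (ℕP.≤-pred b<1+q))

  crossing-outside : a Fin.< b → ∀ {q} → ¬ (a Fin.≤ q × q Fin.< b) → crossing q ≡ 0ℚ
  crossing-outside a<b {q} q∉[a,b[ with b FinP.≤? q
  ... | yes b≤q = trans (cong₂ _+_ (if-yes (a FinP.<? suc q) (s≤s (ℕP.<⇒≤ (ℕP.<-≤-trans a<b b≤q))))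
                                   (if-yes (b FinP.<? suc q) (s≤s b≤q)))
                        (+-inverseʳ 1ℚ)
  ... | no b≰q  = trans (cong₂ _+_ (if-no (a FinP.<? suc q) (λ a<1+q → q∉[a,b[ (ℕP.≤-pred a<1+q , ℕP.≰⇒> b≰q)))
                                   (if-no (b FinP.<? suc q) (λ b<1+q → b≰q (ℕP.≤-pred b<1+q))))
                        (+-identityʳ 0ℚ)

  end-transfer-inside : ∀ {q} → a Fin.≤ q → q Fin.< b → end 0ℚ (transfer W a b s) q ≡ end 0ℚ W q + s
  end-transfer-inside {q} a≤q q<b =
    trans (end-transfer q) (cong (end 0ℚ W q +_) (trans (cong (s *_) (crossing-inside a≤q q<b)) (*-identityʳ s)))

  end-transfer-outside : a Fin.< b → ∀ {q} → ¬ (a Fin.≤ q × q Fin.< b) → end 0ℚ (transfer W a b s) q ≡ end 0ℚ W q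
  end-transfer-outside a<b {q} q∉[a,b[ =
    trans (end-transfer q) (trans (cong (λ r → end 0ℚ W q + s * r) (crossing-outside a<b q∉[a,b[))
                                  (trans (cong (end 0ℚ W q +_) (*-zeroʳ s)) (+-identityʳ (end 0ℚ W q))))

minOf : ∀ n → (Fin n → ℚ) → ℚ → ℚ
minOf zero    g d = d
minOf (suc n) g d = g zero ⊓ minOf n (λ i → g (suc i)) d

minOf≤default : ∀ n g d → minOf n g d ≤ d
minOf≤default zero    g d = ≤-refl
minOf≤default (suc n) g d = ≤-trans (p⊓q≤q (g zero) _) (minOf≤default n (λ i → g (suc i)) d)

minOf≤ : ∀ n g d q → minOf n g d ≤ g q
minOf≤ (suc n) g d zero    = p⊓q≤p (g zero) _
minOf≤ (suc n) g d (suc q) = ≤-trans (p⊓q≤q (g zero) _) (minOf≤ n (λ i → g (suc i)) d q)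

minOf-pos : ∀ n {g d} → (∀ q → 0ℚ < g q) → 0ℚ < d → 0ℚ < minOf n g d
minOf-pos zero    0<g 0<d = 0<d
minOf-pos (suc n) 0<g 0<d = ⊓-pos (0<g zero) (minOf-pos n (λ q → 0<g (suc q)) 0<d)

minOf-attained : ∀ n g d → minOf n g d ≡ d ⊎ ∃[ q ] (minOf n g d ≡ g q)
minOf-attained zero    g d = inj₁ refl
minOf-attained (suc n) g d with ⊓-sel (g zero) (minOf n (λ i → g (suc i)) d)
... | inj₁ ≡g0 = inj₂ (zero , ≡g0)
... | inj₂ ≡rest with minOf-attained n (λ i → g (suc i)) d
...   | inj₁ ≡d       = inj₁ (trans ≡rest ≡d)
...   | inj₂ (q , ≡g) = inj₂ (suc q , trans ≡rest ≡g)

module _ {m : ℕ} where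

  Fractional : (c W : Fin m → ℚ) → Fin m → Set
  Fractional c W i = 0ℚ < W i × W i < c i

  fractional? : ∀ c W i → Dec (Fractional c W i)
  fractional? c W i = (0ℚ <? W i) ×-dec (W i <? c i)

  Tight : (D W : Fin m → ℚ) → Fin m → Set
  Tight D W q = end 0ℚ W q ≡ D q

  TightIn : (D W : Fin m → ℚ) → Fin m → Fin m → Set
  TightIn D W a b = ∃[ q ] (a Fin.≤ q × q Fin.< b × Tight D W q)

  tightIn? : ∀ D W a b → Dec (TightIn D W a b)
  tightIn? D W a b = FinP.any? (λ q → (a FinP.≤? q) ×-dec ((q FinP.<? b) ×-dec (end 0ℚ W q ≟ D q)))

  Separated : (c D W : Fin m → ℚ) → Set
  Separated c D W = ∀ {a b} → a Fin.< b → Fractional c W a → Fractional c W b → TightIn D W a b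

  Unseparated : (c D W : Fin m → ℚ) → Fin m → Set
  Unseparated c D W j = ∃[ f ] (f Fin.< j × Fractional c W f × ¬ TightIn D W f j)

  unseparated? : ∀ c D W j → Dec (Unseparated c D W j)
  unseparated? c D W j = FinP.any? (λ f → (f FinP.<? j) ×-dec (fractional? c W f ×-dec ¬? (tightIn? D W f j)))

  ¬unseparated⇒tightIn : ∀ {c D W a j} → ¬ Unseparated c D W j → a Fin.< j → Fractional c W a → TightIn D W a j
  ¬unseparated⇒tightIn {c} {D} {W} {a} {j} ¬cand a<j frac-a with tightIn? D W a j
  ... | yes tight = tight
  ... | no ¬tight = ⊥-elim (¬cand (a , a<j , frac-a , ¬tight))

module PipageRounding {m : ℕ} (c : Fin m → ℚ) (D : Fin m → ℚ) (Ψ : (Fin m → ℚ) → ℚ)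
  (Ψ-exchange : ∀ W → (∀ i → W i ≤ c i) → ∀ {a b} → a ≢ b → ∀ {s t} → 0ℚ < s → 0ℚ < t →
                Ψ W ≤ Ψ (transfer W a b s) ⊎ Ψ W ≤ Ψ (transfer W a b (- t))) where

  record Admissible (W : Fin m → ℚ) : Set where
    field
      nonNeg  : ∀ i → 0ℚ ≤ W i
      ≤cap    : ∀ i → W i ≤ c i
      prefix≤ : ∀ q → end 0ℚ W q ≤ D q

  SeparatedBelow : (Fin m → ℚ) → ℕ → Set
  SeparatedBelow W k = ∀ {a b} → a Fin.< b → toℕ b ℕ.< k → Fractional c W a → Fractional c W b → TightIn D W a b

  separatedBelow-extend : ∀ {W} j → SeparatedBelow W (toℕ j) →
    (∀ {a} → a Fin.< j → Fractional c W a → Fractional c W j → TightIn D W a j) → SeparatedBelow W (suc (toℕ j))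
  separatedBelow-extend j sep new {b = b} a<b b<1+j fa fb with ℕP.m≤n⇒m<n∨m≡n (ℕP.≤-pred b<1+j)
  ... | inj₁ b<j  = sep a<b b<j fa fb
  ... | inj₂ b≡j with FinP.toℕ-injective {i = b} {j = j} b≡j
  ...   | refl = new a<b fa fb

  module Transfer {W} (adm : Admissible W) {f j : Fin m} (f<j : f Fin.< j) where
    open Admissible adm

    f≢j : f ≢ j
    f≢j f≡j = ℕP.<-irrefl (cong toℕ f≡j) f<j

    transfer-admissible : ∀ s → 0ℚ ≤ W f + s → W f + s ≤ c f → 0ℚ ≤ W j - s → W j - s ≤ c j →
      (∀ {q} → f Fin.≤ q → q Fin.< j → end 0ℚ W q + s ≤ D q) → Admissible (transfer W f j s)
    transfer-admissible s 0≤f′ f′≤c 0≤j′ j′≤c fits = record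
      { nonNeg  = λ i → proj₁ (bounds i)
      ; ≤cap    = λ i → proj₂ (bounds i)
      ; prefix≤ = prefix≤′
      }
      where
      InBox : Fin m → ℚ → Set
      InBox i x = 0ℚ ≤ x × x ≤ c i
      bounds′ : ∀ i → Dec (i ≡ f) → Dec (i ≡ j) → InBox i (transfer W f j s i)
      bounds′ i (yes refl) _          = subst (InBox i) (sym (transfer-at-a W f≢j s)) (0≤f′ , f′≤c)
      bounds′ i (no _)     (yes refl) = subst (InBox i) (sym (transfer-at-b W f≢j s)) (0≤j′ , j′≤c)
      bounds′ i (no i≢f)   (no i≢j)   = subst (InBox i) (sym (transfer-elsewhere W f≢j s i≢f i≢j)) (nonNeg i , ≤cap i)
      bounds : ∀ i → InBox i (transfer W f j s i)
      bounds i = bounds′ i (i FinP.≟ f) (i FinP.≟ j)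
      prefix≤′ : ∀ q → end 0ℚ (transfer W f j s) q ≤ D q
      prefix≤′ q with (f FinP.≤? q) ×-dec (q FinP.<? j)
      ... | yes (f≤q , q<j) = subst (_≤ D q) (sym (end-transfer-inside W f≢j s f≤q q<j)) (fits f≤q q<j)
      ... | no q∉[f,j[      = subst (_≤ D q) (sym (end-transfer-outside W f≢j s f<j q∉[f,j[)) (prefix≤ q)

    tight-preserved : ∀ {s q} → ¬ TightIn D W f j → Tight D W q → Tight D (transfer W f j s) q
    tight-preserved {s} {q} ¬tight tight =
      trans (end-transfer-outside W f≢j s f<j (λ (f≤q , q<j) → ¬tight (q , f≤q , q<j , tight))) tight

    fractional-preserved : ∀ {s i} → i Fin.< j → Fractional c W f → Fractional c (transfer W f j s) i → Fractional c W i
    fractional-preserved {s} {i} i<j frac-f frac′ = by-cases (i FinP.≟ f)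
      where
      i≢j : i ≢ j
      i≢j i≡j = ℕP.<-irrefl (cong toℕ i≡j) i<j
      by-cases : Dec (i ≡ f) → Fractional c W i
      by-cases (yes refl) = frac-f
      by-cases (no i≢f)   = subst (λ x → 0ℚ < x × x < c i) (transfer-elsewhere W f≢j s i≢f i≢j) frac′

    separatedBelow-transfer : ∀ {s} → SeparatedBelow W (toℕ j) → Fractional c W f → ¬ TightIn D W f j →
      (Fractional c (transfer W f j s) f → Fractional c (transfer W f j s) j → TightIn D (transfer W f j s) f j) →
      SeparatedBelow (transfer W f j s) (suc (toℕ j))
    separatedBelow-transfer {s} sep frac-f ¬tight created = separatedBelow-extend j old new
      where
      W′ : Fin m → ℚ
      W′ = transfer W f j s
      old : SeparatedBelow W′ (toℕ j)
      old a<b b<j fa fb with sep a<b b<j (fractional-preserved {s} (ℕP.<-trans a<b b<j) frac-f fa)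
                                         (fractional-preserved {s} b<j frac-f fb)
      ... | q , a≤q , q<b , tight = q , a≤q , q<b , tight-preserved {s} ¬tight tight
      new : ∀ {a} → a Fin.< j → Fractional c W′ a → Fractional c W′ j → TightIn D W′ a j
      new {a} a<j fa fj with FinP.<-cmp a f
      ... | tri≈ _ refl _ = created fa fj
      ... | tri< a<f _ _ with sep a<f f<j (fractional-preserved {s} a<j frac-f fa) frac-f
      ...   | q , a≤q , q<f , tight = q , a≤q , ℕP.<-trans q<f f<j , tight-preserved {s} ¬tight tight
      new {a} a<j fa fj | tri> _ _ f<a with sep f<a a<j frac-f (fractional-preserved {s} a<j frac-f fa)
      ...   | q , f≤q , q<a , tight = ⊥-elim (¬tight (q , f≤q , ℕP.<-trans q<a a<j , tight))

  Improvement : (Fin m → ℚ) → ℕ → Set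
  Improvement W k = ∃[ W′ ] (Admissible W′ × Ψ W ≤ Ψ W′ × SeparatedBelow W′ k)

  module Step {W} (adm : Admissible W) {f j : Fin m} (f<j : f Fin.< j)
              (frac-f : Fractional c W f) (frac-j : Fractional c W j) (¬tight : ¬ TightIn D W f j) where
    open Admissible adm
    open Transfer adm f<j

    inRange? : (q : Fin m) → Dec (f Fin.≤ q × q Fin.< j)
    inRange? q = (f FinP.≤? q) ×-dec (q FinP.<? j)

    slack : Fin m → ℚ
    slack q = D q - end 0ℚ W q

    room : ℚ
    room = (c f - W f) ⊓ W j

    bound : Fin m → ℚ
    bound q = if does (inRange? q) then slack q else room

    δ⁺ δ⁻ : ℚ
    δ⁺ = minOf m bound room
    δ⁻ = W f ⊓ (c j - W j)

    W⁺ W⁻ : Fin m → ℚ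
    W⁺ = transfer W f j δ⁺
    W⁻ = transfer W f j (- δ⁻)

    0<room : 0ℚ < room
    0<room = ⊓-pos (p<q⇒0<q-p (proj₂ frac-f)) (proj₁ frac-j)

    0<slack : ∀ {q} → f Fin.≤ q → q Fin.< j → 0ℚ < slack q
    0<slack {q} f≤q q<j with ≤⇒≡∨< (prefix≤ q)
    ... | inj₁ tight = ⊥-elim (¬tight (q , f≤q , q<j , tight))
    ... | inj₂ below = p<q⇒0<q-p below

    0<bound : ∀ q → 0ℚ < bound q
    0<bound q = at (inRange? q)
      where
      at : Dec (f Fin.≤ q × q Fin.< j) → 0ℚ < bound q
      at (yes (f≤q , q<j)) = subst (0ℚ <_) (sym (if-yes (inRange? q) (f≤q , q<j))) (0<slack f≤q q<j)
      at (no q∉[f,j[)      = subst (0ℚ <_) (sym (if-no (inRange? q) q∉[f,j[)) 0<room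

    0<δ⁺ : 0ℚ < δ⁺
    0<δ⁺ = minOf-pos m 0<bound 0<room

    0<δ⁻ : 0ℚ < δ⁻
    0<δ⁻ = ⊓-pos (proj₁ frac-f) (p<q⇒0<q-p (proj₂ frac-j))

    δ⁺≤room : δ⁺ ≤ room
    δ⁺≤room = minOf≤default m bound room

    δ⁺≤slack : ∀ {q} → f Fin.≤ q → q Fin.< j → δ⁺ ≤ slack q
    δ⁺≤slack {q} f≤q q<j = subst (δ⁺ ≤_) (if-yes (inRange? q) (f≤q , q<j)) (minOf≤ m bound room q)

    W⁺-admissible : Admissible W⁺
    W⁺-admissible = transfer-admissible δ⁺
      (+-nonNeg (nonNeg f) (<⇒≤ 0<δ⁺))
      (p+q≤r⇐q≤r-p (≤-trans δ⁺≤room (p⊓q≤p (c f - W f) (W j))))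
      (p≤q⇒0≤q-p (≤-trans δ⁺≤room (p⊓q≤q (c f - W f) (W j))))
      (≤-trans (p-q≤p (<⇒≤ 0<δ⁺)) (≤cap j))
      (λ f≤q q<j → p+q≤r⇐q≤r-p (δ⁺≤slack f≤q q<j))

    W⁻-admissible : Admissible W⁻
    W⁻-admissible = transfer-admissible (- δ⁻)
      (p≤q⇒0≤q-p (p⊓q≤p (W f) (c j - W j)))
      (≤-trans (p-q≤p (<⇒≤ 0<δ⁻)) (≤cap f))
      (subst (0ℚ ≤_) (sym (p-[-q]≡p+q (W j) δ⁻)) (+-nonNeg (nonNeg j) (<⇒≤ 0<δ⁻)))
      (subst (_≤ c j) (sym (p-[-q]≡p+q (W j) δ⁻)) (p+q≤r⇐q≤r-p (p⊓q≤q (W f) (c j - W j))))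
      (λ {q} _ _ → ≤-trans (p-q≤p (<⇒≤ 0<δ⁻)) (prefix≤ q))

    room-reached : δ⁺ ≡ room → Fractional c W⁺ f → Fractional c W⁺ j → ⊥
    room-reached δ⁺≡room frac⁺-f frac⁺-j with ⊓-sel (c f - W f) (W j)
    ... | inj₁ ≡gap = <-irrefl (begin
          W⁺ f              ≡⟨ transfer-at-a W f≢j δ⁺ ⟩
          W f + δ⁺          ≡⟨ cong (W f +_) (trans δ⁺≡room ≡gap) ⟩
          W f + (c f - W f) ≡⟨ p+[q-p]≡q (W f) (c f) ⟩
          c f               ∎) (proj₂ frac⁺-f)
      where open ≡-Reasoning
    ... | inj₂ ≡Wj  = <-irrefl (sym (begin
          W⁺ j              ≡⟨ transfer-at-b W f≢j δ⁺ ⟩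
          W j - δ⁺          ≡⟨ cong (λ x → W j - x) (trans δ⁺≡room ≡Wj) ⟩
          W j - W j         ≡⟨ +-inverseʳ (W j) ⟩
          0ℚ                ∎)) (proj₁ frac⁺-j)
      where open ≡-Reasoning

    W⁺-separates : Fractional c W⁺ f → Fractional c W⁺ j → TightIn D W⁺ f j
    W⁺-separates frac⁺-f frac⁺-j with minOf-attained m bound room
    ... | inj₁ δ⁺≡room         = ⊥-elim (room-reached δ⁺≡room frac⁺-f frac⁺-j)
    ... | inj₂ (q , δ⁺≡bound) = at (inRange? q)
      where
      at : Dec (f Fin.≤ q × q Fin.< j) → TightIn D W⁺ f j
      at (yes (f≤q , q<j)) = q , f≤q , q<j , (begin
        end 0ℚ W⁺ q                     ≡⟨ end-transfer-inside W f≢j δ⁺ f≤q q<j ⟩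
        end 0ℚ W q + δ⁺                 ≡⟨ cong (end 0ℚ W q +_) (trans δ⁺≡bound (if-yes (inRange? q) (f≤q , q<j))) ⟩
        end 0ℚ W q + slack q            ≡⟨ p+[q-p]≡q (end 0ℚ W q) (D q) ⟩
        D q                             ∎)
        where open ≡-Reasoning
      at (no q∉[f,j[) = ⊥-elim (room-reached (trans δ⁺≡bound (if-no (inRange? q) q∉[f,j[)) frac⁺-f frac⁺-j)

    W⁻-separates : Fractional c W⁻ f → Fractional c W⁻ j → TightIn D W⁻ f j
    W⁻-separates frac⁻-f frac⁻-j with ⊓-sel (W f) (c j - W j)
    ... | inj₁ ≡Wf  = ⊥-elim (<-irrefl (sym (begin
          W⁻ f              ≡⟨ transfer-at-a W f≢j (- δ⁻) ⟩
          W f - δ⁻          ≡⟨ cong (λ x → W f - x) ≡Wf ⟩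
          W f - W f         ≡⟨ +-inverseʳ (W f) ⟩
          0ℚ                ∎)) (proj₁ frac⁻-f))
      where open ≡-Reasoning
    ... | inj₂ ≡gap = ⊥-elim (<-irrefl (begin
          W⁻ j              ≡⟨ transfer-at-b W f≢j (- δ⁻) ⟩
          W j - (- δ⁻)      ≡⟨ p-[-q]≡p+q (W j) δ⁻ ⟩
          W j + δ⁻          ≡⟨ cong (W j +_) ≡gap ⟩
          W j + (c j - W j) ≡⟨ p+[q-p]≡q (W j) (c j) ⟩
          c j               ∎) (proj₂ frac⁻-j))
      where open ≡-Reasoning

    improve : SeparatedBelow W (toℕ j) → Improvement W (suc (toℕ j))
    improve sep with Ψ-exchange W ≤cap f≢j 0<δ⁺ 0<δ⁻
    ... | inj₁ Ψ≤ = W⁺ , W⁺-admissible , Ψ≤ , separatedBelow-transfer {δ⁺} sep frac-f ¬tight W⁺-separates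
    ... | inj₂ Ψ≤ = W⁻ , W⁻-admissible , Ψ≤ , separatedBelow-transfer { - δ⁻} sep frac-f ¬tight W⁻-separates

  step : ∀ W → Admissible W → ∀ j → SeparatedBelow W (toℕ j) → Improvement W (suc (toℕ j))
  step W adm j sep with fractional? c W j
  ... | no ¬frac-j = W , adm , ≤-refl , separatedBelow-extend j sep (λ _ _ frac-j → ⊥-elim (¬frac-j frac-j))
  ... | yes frac-j with unseparated? c D W j
  ...   | no ¬cand = W , adm , ≤-refl , separatedBelow-extend j sep (λ a<j frac-a _ → ¬unseparated⇒tightIn ¬cand a<j frac-a)
  ...   | yes (f , f<j , frac-f , ¬tight) = Step.improve adm f<j frac-f frac-j ¬tight sep

  improveBelow : ∀ W → Admissible W → ∀ k → k ℕ.≤ m → Improvement W k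
  improveBelow W adm zero    _   = W , adm , ≤-refl , λ _ ()
  improveBelow W adm (suc k) k<m with improveBelow W adm k (ℕP.<⇒≤ k<m)
  ... | W′ , adm′ , Ψ≤Ψ′ , sep′
      with step W′ adm′ (Fin.fromℕ< k<m) (subst (SeparatedBelow W′) (sym (FinP.toℕ-fromℕ< k<m)) sep′)
  ...   | W″ , adm″ , Ψ′≤Ψ″ , sep″ =
        W″ , adm″ , ≤-trans Ψ≤Ψ′ Ψ′≤Ψ″ , subst (λ k → SeparatedBelow W″ (suc k)) (FinP.toℕ-fromℕ< k<m) sep″

  pipage-round : ∀ W → Admissible W → ∃[ W′ ] (Admissible W′ × Ψ W ≤ Ψ W′ × Separated c D W′)
  pipage-round W adm with improveBelow W adm m ℕP.≤-refl
  ... | W′ , adm′ , Ψ≤Ψ′ , sep = W′ , adm′ , Ψ≤Ψ′ , λ a<b → sep a<b (FinP.toℕ<n _)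

-- Laying out weights along the knapsacks

usable : ∀ {m p} → (Fin m → ℚ) → (Fin p → ℚ) → Fin m → ℚ
usable {p = p} c B q = ∑ p (λ k → if does (c q ≤? B k) then B k else 0ℚ)

module Layout {m p : ℕ} (c : Fin m → ℚ) (0<c : ∀ j → 0ℚ < c j)
              (B : Fin p → ℚ) (0<B : ∀ k → 0ℚ < B k) (B-sorted : ∀ {u v} → u Fin.≤ v → B v ≤ B u)
              (w : Fin m → ℚ) (0≤w : NonNeg w) (w≤c : ∀ j → w j ≤ c j)
              (w-prefix : ∀ q → end 0ℚ w q ≤ usable c B q) where

  D : Fin m → ℚ
  D = usable c B

  0≤B : NonNeg B
  0≤B k = <⇒≤ (0<B k)

  binStart binEnd : Fin p → ℚ
  binStart = start 0ℚ B
  binEnd   = end 0ℚ B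

  capTotal : ℚ
  capTotal = total p 0ℚ B

  setStart setEnd : Fin m → ℚ
  setStart = start 0ℚ w
  setEnd   = end 0ℚ w

  D≤binStart : ∀ q k → (∀ {k′} → c q ≤ B k′ → k′ Fin.< k) → D q ≤ binStart k
  D≤binStart q k before = subst (D q ≤_) (sym (trans (start-as-∑ 0ℚ B k) (+-identityˡ _)))
    (∑-mono-≤ p (λ k′ → indicator-mono (c q ≤? B k′) (k′ FinP.<? k) (0≤B k′) before))

  binEnd≤D : ∀ q k → (∀ {k′} → k′ Fin.≤ k → c q ≤ B k′) → binEnd k ≤ D q
  binEnd≤D q k fits = subst (_≤ D q) (sym (trans (end-as-∑ 0ℚ B k) (+-identityˡ _)))
    (∑-mono-≤ p (λ k′ → indicator-mono (k′ FinP.<? suc k) (c q ≤? B k′) (0≤B k′) (λ k′<1+k → fits (ℕP.≤-pred k′<1+k))))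

  D≤capTotal : ∀ q → D q ≤ capTotal
  D≤capTotal q = subst (D q ≤_) (sym (trans (total-as-∑ p 0ℚ B) (+-identityˡ _)))
    (∑-mono-≤ p (λ k → indicator≤ (does (c q ≤? B k)) (0≤B k)))

  -- The knapsacks that can hold set q form a prefix of the sorted list, so D q is a bin boundary.
  D-not-inside : ∀ q k → binStart k < D q → D q < binEnd k → ⊥
  D-not-inside q k start< <end with c q ≤? B k
  ... | yes cq≤Bk = <-≤-contradiction <end (binEnd≤D q k (λ k′≤k → ≤-trans cq≤Bk (B-sorted k′≤k)))
  ... | no cq≰Bk  = <-≤-contradiction start< (D≤binStart q k before)
    where
    before : ∀ {k′} → c q ≤ B k′ → k′ Fin.< k
    before {k′} cq≤Bk′ = ℕP.≰⇒> (λ k≤k′ → cq≰Bk (≤-trans cq≤Bk′ (B-sorted k≤k′)))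

  setEnd≤capTotal : ∀ j → setEnd j ≤ capTotal
  setEnd≤capTotal j = ≤-trans (w-prefix j) (D≤capTotal j)

  ic : Fin m → ℚ
  ic j = inverse (c j) (0<c j)

  0<ic : ∀ j → 0ℚ < ic j
  0<ic j = 0<inverse (0<c j)

  c*ic≡1 : ∀ j → c j * ic j ≡ 1ℚ
  c*ic≡1 j = *-inverse (0<c j)

  clampBin : ℚ → Fin p → ℚ
  clampBin z k = clamp z (binStart k) (binEnd k)

  inBin : Fin m → Fin p → ℚ
  inBin j k = clampBin (setEnd j) k - clampBin (setStart j) k

  x : Fin m → Fin p → ℚ
  x j k = inBin j k * ic j

  setStart≤setEnd : ∀ j → setStart j ≤ setEnd j
  setStart≤setEnd = start≤end 0≤w 0ℚ

  binStart≤binEnd : ∀ k → binStart k ≤ binEnd k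
  binStart≤binEnd = start≤end 0≤B 0ℚ

  0≤inBin : ∀ j k → 0ℚ ≤ inBin j k
  0≤inBin j k = p≤q⇒0≤q-p (clamp-mono (binStart k) (binEnd k) (setStart≤setEnd j))

  inBin≤w : ∀ j k → inBin j k ≤ w j
  inBin≤w j k = ≤-by-difference
    (solve 3 (λ v a b → v :- (a :- b) := (b :+ v) :- a) refl (w j) (clampBin (setEnd j) k) (clampBin (setStart j) k))
    (p≤q⇒0≤q-p (subst (λ d → clampBin (setEnd j) k ≤ clampBin (setStart j) k + d)
      (solve 2 (λ s v → (s :+ v) :- s := v) refl (setStart j) (w j))
      (clamp-1-Lipschitz (binStart k) (binEnd k) (setStart≤setEnd j))))

  share : Fin m → ℚ
  share j = w j * ic j

  x≤share : ∀ j k → x j k ≤ share j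
  x≤share j k = *-monoʳ-≤-nonNeg (ic j) {{nonNegative (<⇒≤ (0<ic j))}} (inBin≤w j k)

  share≤1 : ∀ j → share j ≤ 1ℚ
  share≤1 j = ≤⇒*inverse≤1 (0<c j) (w≤c j)

  0≤x : ∀ j k → 0ℚ ≤ x j k
  0≤x j k = *-nonNeg (0≤inBin j k) (<⇒≤ (0<ic j))

  x≤1 : ∀ j k → x j k ≤ 1ℚ
  x≤1 j k = ≤-trans (x≤share j k) (share≤1 j)

  ∑-inBin : ∀ j → ∑ p (inBin j) ≡ w j
  ∑-inBin j = begin
    ∑ p (λ k → clampBin (setEnd j) k - clampBin (setStart j) k)
      ≡⟨ ∑-cong p (λ k → solve 3 (λ a b s → a :- b := (a :- s) :- (b :- s)) refl
                           (clampBin (setEnd j) k) (clampBin (setStart j) k) (binStart k)) ⟩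
    ∑ p (λ k → (clampBin (setEnd j) k - binStart k) - (clampBin (setStart j) k - binStart k))
      ≡⟨ ∑-distrib-- p _ _ ⟩
    ∑ p (λ k → clampBin (setEnd j) k - binStart k) - ∑ p (λ k → clampBin (setStart j) k - binStart k)
      ≡⟨ cong₂ _-_ (∑-clamp-layout p 0ℚ 0≤B (setEnd j)) (∑-clamp-layout p 0ℚ 0≤B (setStart j)) ⟩
    (clamp (setEnd j) 0ℚ capTotal - 0ℚ) - (clamp (setStart j) 0ℚ capTotal - 0ℚ)
      ≡⟨ cong₂ (λ a b → (a - 0ℚ) - (b - 0ℚ))
           (clamp-inside (≤-trans (u≤start 0≤w 0ℚ j) (setStart≤setEnd j)) (setEnd≤capTotal j))
           (clamp-inside (u≤start 0≤w 0ℚ j) (≤-trans (setStart≤setEnd j) (setEnd≤capTotal j))) ⟩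
    (setEnd j - 0ℚ) - (setStart j - 0ℚ)
      ≡⟨ solve 2 (λ s v → ((s :+ v) :- con 0ℚ) :- (s :- con 0ℚ) := v) refl (setStart j) (w j) ⟩
    w j ∎
    where open ≡-Reasoning

  ∑-x : ∀ j → ∑ p (x j) ≡ share j
  ∑-x j = trans (∑-cong p (λ k → *-comm (inBin j k) (ic j)))
         (trans (*-distribˡ-∑ p (ic j) (inBin j)) (trans (cong (ic j *_) (∑-inBin j)) (*-comm (ic j) (w j))))

  c*x≡inBin : ∀ j k → c j * x j k ≡ inBin j k
  c*x≡inBin j k = begin
    c j * (inBin j k * ic j)  ≡⟨ solve 3 (λ c o i → c :* (o :* i) := o :* (c :* i)) refl (c j) (inBin j k) (ic j) ⟩
    inBin j k * (c j * ic j)  ≡⟨ cong (inBin j k *_) (c*ic≡1 j) ⟩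
    inBin j k * 1ℚ            ≡⟨ *-identityʳ (inBin j k) ⟩
    inBin j k                 ∎
    where open ≡-Reasoning

  ∑-cost-x : ∀ k → ∑ m (λ j → c j * x j k) ≤ B k
  ∑-cost-x k = subst (_≤ B k) (sym (trans (∑-cong m (λ j → c*x≡inBin j k)) (∑-telescope m (λ z → clampBin z k) 0ℚ w)))
    (≤-by-difference (solve 4 (λ s b t0 t1 → b :- (t1 :- t0) := ((s :+ b) :- t1) :+ (t0 :- s)) refl
                       (binStart k) (B k) (clampBin 0ℚ k) (clampBin (total m 0ℚ w) k))
      (+-nonNeg (p≤q⇒0≤q-p (clamp≤hi (total m 0ℚ w) (binStart k) (binEnd k)))
                (p≤q⇒0≤q-p (lo≤clamp 0ℚ (binStart≤binEnd k)))))

  x-absent : ∀ j k → B k < c j → x j k ≡ 0ℚ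
  x-absent j k Bk<cj = begin
    (clampBin (setEnd j) k - clampBin (setStart j) k) * ic j  ≡⟨ cong (λ r → r * ic j) (cong₂ _-_
                                                                   (clamp-below end≤ (binStart≤binEnd k))
                                                                   (clamp-below (≤-trans (setStart≤setEnd j) end≤) (binStart≤binEnd k))) ⟩
    (binStart k - binStart k) * ic j                          ≡⟨ cong (_* ic j) (+-inverseʳ (binStart k)) ⟩
    0ℚ * ic j                                                 ≡⟨ *-zeroˡ (ic j) ⟩
    0ℚ                                                        ∎
    where
    open ≡-Reasoning
    before : ∀ {k′} → c j ≤ B k′ → k′ Fin.< k
    before {k′} cj≤Bk′ = ℕP.≰⇒> (λ k≤k′ → <-≤-contradiction Bk<cj (≤-trans cj≤Bk′ (B-sorted k≤k′)))
    end≤ : setEnd j ≤ binStart k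
    end≤ = ≤-trans (w-prefix j) (D≤binStart j k before)

  Inside : Fin m → Fin p → Set
  Inside j k = binStart k ≤ setStart j × setEnd j ≤ binEnd k

  EndsIn StartsIn : Fin m → Fin p → Set
  EndsIn   j k = binStart k < setEnd j × setEnd j ≤ binEnd k
  StartsIn j k = binStart k ≤ setStart j × setStart j < binEnd k

  x≡share : ∀ j k → Inside j k → x j k ≡ share j
  x≡share j k (s≥ , e≤) = cong (_* ic j) (begin
    clampBin (setEnd j) k - clampBin (setStart j) k  ≡⟨ cong₂ _-_ (clamp-inside (≤-trans s≥ (setStart≤setEnd j)) e≤)
                                                                  (clamp-inside s≥ (≤-trans (setStart≤setEnd j) e≤)) ⟩
    setEnd j - setStart j                            ≡⟨ solve 2 (λ s v → (s :+ v) :- s := v) refl (setStart j) (w j) ⟩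
    w j                                              ∎)
    where open ≡-Reasoning

  x≡0-of-equal-clamps : ∀ j k {v} → clampBin (setEnd j) k ≡ v → clampBin (setStart j) k ≡ v → x j k ≡ 0ℚ
  x≡0-of-equal-clamps j k {v} e≡v s≡v = trans (cong (_* ic j) (trans (cong₂ _-_ e≡v s≡v) (+-inverseʳ v))) (*-zeroˡ (ic j))

  x≡0-outside : ∀ j k → Inside j k → ∀ k′ → k′ ≢ k → x j k′ ≡ 0ℚ
  x≡0-outside j k (s≥ , e≤) k′ k′≢k with FinP.<-cmp k′ k
  ... | tri≈ _ k′≡k _ = ⊥-elim (k′≢k k′≡k)
  ... | tri< k′<k _ _ = x≡0-of-equal-clamps j k′ (clamp-above (≤-trans end≤ (setStart≤setEnd j)) (binStart≤binEnd k′))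
                                     (clamp-above end≤ (binStart≤binEnd k′))
    where
    end≤ : binEnd k′ ≤ setStart j
    end≤ = ≤-trans (end≤start 0≤B 0ℚ k′<k) s≥
  ... | tri> _ _ k<k′ = x≡0-of-equal-clamps j k′ (clamp-below ≤start (binStart≤binEnd k′))
                                     (clamp-below (≤-trans (setStart≤setEnd j) ≤start) (binStart≤binEnd k′))
    where
    ≤start : setEnd j ≤ binStart k′
    ≤start = ≤-trans e≤ (end≤start 0≤B 0ℚ k<k′)

  <c⇒*ic<1 : ∀ {j z} → z < c j → z * ic j < 1ℚ
  <c⇒*ic<1 {j} {z} z<c = subst (z * ic j <_) (c*ic≡1 j) (*-monoˡ-<-pos (ic j) {{positive (0<ic j)}} z<c)

  edge⇒0<w : ∀ j k → Edge x j k → 0ℚ < w j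
  edge⇒0<w j k (0<x , _) with ≤⇒≡∨< (0≤w j)
  ... | inj₂ 0<wj = 0<wj
  ... | inj₁ 0≡wj = ⊥-elim (<-≤-contradiction 0<x
                      (≤-trans (x≤share j k) (≤-reflexive (trans (cong (_* ic j) (sym 0≡wj)) (*-zeroˡ (ic j))))))

  fractional-inside : ∀ j k k₀ → Inside j k → Edge x j k₀ → Fractional c w j
  fractional-inside j k k₀ inside edge = edge⇒0<w j k₀ edge , w<c
    where
    w<c : w j < c j
    w<c with ≤⇒≡∨< (w≤c j) | k₀ FinP.≟ k
    ... | inj₂ w<c | _           = w<c
    ... | inj₁ w≡c | yes refl = ⊥-elim (<-irrefl (trans (x≡share j k inside) (trans (cong (_* ic j) w≡c) (c*ic≡1 j)))
                                                  (proj₂ edge))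
    ... | inj₁ _   | no k₀≢k  = ⊥-elim (<-irrefl (sym (x≡0-outside j k inside k₀ k₀≢k)) (proj₁ edge))

  edge-inside : ∀ j k k₀ → Inside j k → Edge x j k₀ → Edge x j k
  edge-inside j k k₀ inside edge with fractional-inside j k k₀ inside edge
  ... | 0<wj , wj<cj = subst (λ v → 0ℚ < v × v < 1ℚ) (sym (x≡share j k inside))
                         (*-pos 0<wj (0<ic j) , <c⇒*ic<1 wj<cj)

  setEnd-v<w : ∀ {j v} → setStart j < v → setEnd j - v < w j
  setEnd-v<w {j} {v} s<v = subst (setEnd j - v <_) (solve 2 (λ s w → (s :+ w) :- s := w) refl (setStart j) (w j))
                                 (+-monoʳ-< (setEnd j) (neg-antimono-< s<v))

  v-setStart<w : ∀ {j v} → v < setEnd j → v - setStart j < w j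
  v-setStart<w {j} {v} v<e = subst (v - setStart j <_) (solve 2 (λ s w → (s :+ w) :- s := w) refl (setStart j) (w j))
                                   (+-monoˡ-< (- setStart j) v<e)

  edge-at-end : ∀ j k k₀ → EndsIn j k → Edge x j k₀ → Edge x j k
  edge-at-end j k k₀ (start<e , e≤end) edge with ≤-total (binStart k) (setStart j)
  ... | inj₁ start≤s = edge-inside j k k₀ (start≤s , e≤end) edge
  ... | inj₂ s≤start with ≤⇒≡∨< s≤start
  ...   | inj₁ s≡start = edge-inside j k k₀ (≤-reflexive (sym s≡start) , e≤end) edge
  ...   | inj₂ s<start = subst (λ v → 0ℚ < v × v < 1ℚ) (sym x≡)
                           (*-pos (p<q⇒0<q-p start<e) (0<ic j) , <c⇒*ic<1 (<-≤-trans (setEnd-v<w s<start) (w≤c j)))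
    where
    x≡ : x j k ≡ (setEnd j - binStart k) * ic j
    x≡ = cong (_* ic j) (cong₂ _-_ (clamp-inside (<⇒≤ start<e) e≤end) (clamp-below s≤start (binStart≤binEnd k)))

  edge-at-start : ∀ j k k₀ → StartsIn j k → Edge x j k₀ → Edge x j k
  edge-at-start j k k₀ (start≤s , s<end) edge with ≤-total (setEnd j) (binEnd k)
  ... | inj₁ e≤end = edge-inside j k k₀ (start≤s , e≤end) edge
  ... | inj₂ end≤e with ≤⇒≡∨< end≤e
  ...   | inj₁ end≡e = edge-inside j k k₀ (start≤s , ≤-reflexive (sym end≡e)) edge
  ...   | inj₂ end<e = subst (λ v → 0ℚ < v × v < 1ℚ) (sym x≡)
                         (*-pos (p<q⇒0<q-p s<end) (0<ic j) , <c⇒*ic<1 (<-≤-trans (v-setStart<w end<e) (w≤c j)))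
    where
    x≡ : x j k ≡ (binEnd k - setStart j) * ic j
    x≡ = cong (_* ic j) (cong₂ _-_ (clamp-above end≤e (binStart≤binEnd k)) (clamp-inside start≤s (<⇒≤ s<end)))

  crosses-or-fractional-start : ∀ j k → StartsIn j k → Edge x j k → binEnd k < setEnd j ⊎ Fractional c w j
  crosses-or-fractional-start j k (start≤s , _) edge with ≤-total (setEnd j) (binEnd k)
  ... | inj₁ e≤end = inj₂ (fractional-inside j k k (start≤s , e≤end) edge)
  ... | inj₂ end≤e with ≤⇒≡∨< end≤e
  ...   | inj₁ end≡e = inj₂ (fractional-inside j k k (start≤s , ≤-reflexive (sym end≡e)) edge)
  ...   | inj₂ end<e = inj₁ end<e

  crosses-or-fractional-end : ∀ j k → EndsIn j k → Edge x j k → setStart j < binStart k ⊎ Fractional c w j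
  crosses-or-fractional-end j k (_ , e≤end) edge with ≤-total (binStart k) (setStart j)
  ... | inj₁ start≤s = inj₂ (fractional-inside j k k (start≤s , e≤end) edge)
  ... | inj₂ s≤start with ≤⇒≡∨< s≤start
  ...   | inj₁ s≡start = inj₂ (fractional-inside j k k (≤-reflexive (sym s≡start) , e≤end) edge)
  ...   | inj₂ s<start = inj₁ s<start

  tight-not-inside : ∀ q k → Tight D w q → binStart k < setEnd q → setEnd q < binEnd k → ⊥
  tight-not-inside q k tight start< <end =
    D-not-inside q k (subst (binStart k <_) tight start<) (subst (_< binEnd k) tight <end)

  setEnd≤setStart : ∀ {a b} → a Fin.< b → setEnd a ≤ setStart b
  setEnd≤setStart = end≤start 0≤w 0ℚ

  setStart<setEnd : ∀ {j} → 0ℚ < w j → setStart j < setEnd j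
  setStart<setEnd {j} = start<end 0ℚ j

  setEnd-mono : ∀ {a b} → a Fin.≤ b → setEnd a ≤ setEnd b
  setEnd-mono = end-mono 0≤w 0ℚ

  setStart-mono : ∀ {a b} → a Fin.≤ b → setStart a ≤ setStart b
  setStart-mono = start-mono 0≤w 0ℚ

  module Matching (separated : Separated c D w) where

    -- A set is matched where it ends if it follows the fractional set of its block, else where it starts.
    Rule : Fin m → Fin p → Set
    Rule j k = (Unseparated c D w j × EndsIn j k) ⊎ (¬ Unseparated c D w j × StartsIn j k)

    Matched : Fin m → Fin p → Set
    Matched j k = Edge x j k × Rule j k

    start-start : ∀ {j₁ j₂ k} → j₁ Fin.< j₂ →
                  Edge x j₁ k → StartsIn j₁ k → ¬ Unseparated c D w j₂ → StartsIn j₂ k → ⊥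
    start-start {j₁} {j₂} {k} j₁<j₂ edge₁ (start≤s₁ , s₁<end) ¬unsep₂ (_ , s₂<end)
      with crosses-or-fractional-start j₁ k (start≤s₁ , s₁<end) edge₁
    ... | inj₁ end<e₁ = <-≤-contradiction end<e₁ (<⇒≤ (≤-<-trans (setEnd≤setStart j₁<j₂) s₂<end))
    ... | inj₂ frac₁ with ¬unseparated⇒tightIn ¬unsep₂ j₁<j₂ frac₁
    ...   | q , j₁≤q , q<j₂ , tight = tight-not-inside q k tight
            (≤-<-trans start≤s₁ (<-≤-trans (setStart<setEnd (proj₁ frac₁)) (setEnd-mono j₁≤q)))
            (≤-<-trans (setEnd≤setStart q<j₂) s₂<end)

    end-end : ∀ {j₁ j₂ k} → j₁ Fin.< j₂ →
              Unseparated c D w j₁ → EndsIn j₁ k → Edge x j₂ k → EndsIn j₂ k → ⊥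
    end-end {j₁} {j₂} {k} j₁<j₂ (a , a<j₁ , frac-a , ¬tight) (start<e₁ , _) edge₂ ends₂
      with crosses-or-fractional-end j₂ k ends₂ edge₂
    ... | inj₁ s₂<start = <-≤-contradiction start<e₁ (<⇒≤ (≤-<-trans (setEnd≤setStart j₁<j₂) s₂<start))
    ... | inj₂ frac₂ with separated (ℕP.<-trans a<j₁ j₁<j₂) frac-a frac₂
    ...   | q , a≤q , q<j₂ , tight with q FinP.<? j₁
    ...     | yes q<j₁ = ¬tight (q , a≤q , q<j₁ , tight)
    ...     | no q≮j₁  = tight-not-inside q k tight
              (<-≤-trans start<e₁ (setEnd-mono (ℕP.≮⇒≥ q≮j₁)))
              (≤-<-trans (setEnd≤setStart q<j₂) (<-≤-trans (setStart<setEnd (proj₁ frac₂)) (proj₂ ends₂)))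

    start-end : ∀ {j₁ j₂ k} → j₁ Fin.< j₂ →
                Edge x j₁ k → StartsIn j₁ k → Unseparated c D w j₂ → Edge x j₂ k → EndsIn j₂ k → ⊥
    start-end {j₁} {j₂} {k} j₁<j₂ edge₁ starts₁ (a , a<j₂ , frac-a , ¬tight) edge₂ ends₂
      with crosses-or-fractional-start j₁ k starts₁ edge₁
    ... | inj₁ end<e₁ = <-≤-contradiction end<e₁
            (≤-trans (setEnd≤setStart j₁<j₂) (≤-trans (setStart≤setEnd j₂) (proj₂ ends₂)))
    ... | inj₂ frac₁ with FinP.<-cmp a j₁
    ...   | tri< a<j₁ _ _ with separated a<j₁ frac-a frac₁
    ...     | q , a≤q , q<j₁ , tight = ¬tight (q , a≤q , ℕP.<-trans q<j₁ j₁<j₂ , tight)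
    start-end {j₁} {j₂} {k} j₁<j₂ edge₁ starts₁ (a , a<j₂ , frac-a , ¬tight) edge₂ ends₂
      | inj₂ frac₁ | tri≈ _ refl _ with crosses-or-fractional-end j₂ k ends₂ edge₂
    ...     | inj₁ s₂<start = <-≤-contradiction s₂<start
              (≤-trans (proj₁ starts₁) (≤-trans (setStart≤setEnd j₁) (setEnd≤setStart j₁<j₂)))
    ...     | inj₂ frac₂ = ¬tight (separated j₁<j₂ frac₁ frac₂)
    start-end {j₁} {j₂} {k} j₁<j₂ edge₁ starts₁ (a , a<j₂ , frac-a , ¬tight) edge₂ ends₂
      | inj₂ frac₁ | tri> _ _ j₁<a with separated j₁<a frac₁ frac-a
    ...     | q , j₁≤q , q<a , tight = tight-not-inside q k tight
              (≤-<-trans (proj₁ starts₁) (<-≤-trans (setStart<setEnd (proj₁ frac₁)) (setEnd-mono j₁≤q)))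
              (≤-<-trans (setEnd≤setStart q<a) (≤-<-trans (setStart-mono (ℕP.<⇒≤ a<j₂))
                (<-≤-trans (setStart<setEnd (edge⇒0<w j₂ k edge₂)) (proj₂ ends₂))))

    end-start : ∀ {j₁ j₂ k} → j₁ Fin.< j₂ →
                Unseparated c D w j₁ → EndsIn j₁ k → ¬ Unseparated c D w j₂ → StartsIn j₂ k → ⊥
    end-start {j₁} {j₂} {k} j₁<j₂ (a , a<j₁ , frac-a , ¬tight) (start<e₁ , _) ¬unsep₂ (_ , s₂<end)
      with ¬unseparated⇒tightIn ¬unsep₂ (ℕP.<-trans a<j₁ j₁<j₂) frac-a
    ... | q , a≤q , q<j₂ , tight with q FinP.<? j₁
    ...   | yes q<j₁ = ¬tight (q , a≤q , q<j₁ , tight)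
    ...   | no q≮j₁  = tight-not-inside q k tight
            (<-≤-trans start<e₁ (setEnd-mono (ℕP.≮⇒≥ q≮j₁)))
            (≤-<-trans (setEnd≤setStart q<j₂) s₂<end)

    matched-ordered : ∀ {j₁ j₂ k} → j₁ Fin.< j₂ → Matched j₁ k → Matched j₂ k → ⊥
    matched-ordered {k = k} j₁<j₂ (edge₁ , inj₁ (unsep₁ , ends₁)) (edge₂ , inj₁ (_ , ends₂)) =
      end-end {k = k} j₁<j₂ unsep₁ ends₁ edge₂ ends₂
    matched-ordered {k = k} j₁<j₂ (edge₁ , inj₁ (unsep₁ , ends₁)) (edge₂ , inj₂ (¬unsep₂ , starts₂)) =
      end-start {k = k} j₁<j₂ unsep₁ ends₁ ¬unsep₂ starts₂
    matched-ordered {k = k} j₁<j₂ (edge₁ , inj₂ (_ , starts₁)) (edge₂ , inj₁ (unsep₂ , ends₂)) =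
      start-end {k = k} j₁<j₂ edge₁ starts₁ unsep₂ edge₂ ends₂
    matched-ordered {k = k} j₁<j₂ (edge₁ , inj₂ (_ , starts₁)) (edge₂ , inj₂ (¬unsep₂ , starts₂)) =
      start-start {k = k} j₁<j₂ edge₁ starts₁ ¬unsep₂ starts₂

    matched? : ∀ j k → Dec (Matched j k)
    matched? j k = ((0ℚ <? x j k) ×-dec (x j k <? 1ℚ)) ×-dec
      ((unseparated? c D w j ×-dec ((binStart k <? setEnd j) ×-dec (setEnd j ≤? binEnd k))) ⊎-dec
       (¬? (unseparated? c D w j) ×-dec ((binStart k ≤? setStart j) ×-dec (setStart j <? binEnd k))))

    opaque
      M : Fin m → Fin p → Bool
      M j k = does (matched? j k)

      M⇒matched : ∀ j k → M j k ≡ true → Matched j k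
      M⇒matched j k = does-true⇒ (matched? j k)

      matched⇒M : ∀ j k → Matched j k → M j k ≡ true
      matched⇒M j k = dec-true (matched? j k)

    M-unique-set : ∀ j j′ k → M j k ≡ true → M j′ k ≡ true → j ≡ j′
    M-unique-set j j′ k Mjk Mj′k with FinP.<-cmp j j′
    ... | tri< j<j′ _ _ = ⊥-elim (matched-ordered {k = k} j<j′ (M⇒matched j k Mjk) (M⇒matched j′ k Mj′k))
    ... | tri≈ _ j≡j′ _ = j≡j′
    ... | tri> _ _ j′<j = ⊥-elim (matched-ordered {k = k} j′<j (M⇒matched j′ k Mj′k) (M⇒matched j k Mjk))

    M-unique-bin : ∀ j k k′ → M j k ≡ true → M j k′ ≡ true → k ≡ k′
    M-unique-bin j k k′ Mjk Mjk′ with proj₂ (M⇒matched j k Mjk) | proj₂ (M⇒matched j k′ Mjk′) | FinP.<-cmp k k′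
    ... | _ | _ | tri≈ _ k≡k′ _ = k≡k′
    ... | inj₁ (unsep , _) | inj₂ (¬unsep , _) | _ = ⊥-elim (¬unsep unsep)
    ... | inj₂ (¬unsep , _) | inj₁ (unsep , _) | _ = ⊥-elim (¬unsep unsep)
    ... | inj₁ (_ , (_ , e≤end)) | inj₁ (_ , (start′<e , _)) | tri< k<k′ _ _ =
          ⊥-elim (<-≤-contradiction start′<e (≤-trans e≤end (end≤start 0≤B 0ℚ k<k′)))
    ... | inj₁ (_ , (start<e , _)) | inj₁ (_ , (_ , e≤end′)) | tri> _ _ k′<k =
          ⊥-elim (<-≤-contradiction start<e (≤-trans e≤end′ (end≤start 0≤B 0ℚ k′<k)))
    ... | inj₂ (_ , (_ , s<end)) | inj₂ (_ , (start′≤s , _)) | tri< k<k′ _ _ =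
          ⊥-elim (<-≤-contradiction s<end (≤-trans (end≤start 0≤B 0ℚ k<k′) start′≤s))
    ... | inj₂ (_ , (start≤s , _)) | inj₂ (_ , (_ , s<end′)) | tri> _ _ k′<k =
          ⊥-elim (<-≤-contradiction s<end′ (≤-trans (end≤start 0≤B 0ℚ k′<k) start≤s))

    M-saturating : Saturating x M
    M-saturating j (k₀ , edge) = saturate (unseparated? c D w j)
      where
      s<e : setStart j < setEnd j
      s<e = setStart<setEnd (edge⇒0<w j k₀ edge)
      saturate : Dec (Unseparated c D w j) → ∃[ k ] (M j k ≡ true)
      saturate (yes unsep) with locate-end p 0ℚ 0≤B (≤-<-trans (u≤start 0≤w 0ℚ j) s<e) (setEnd≤capTotal j)
      ... | k , ends = k , matched⇒M j k (edge-at-end j k k₀ ends edge , inj₁ (unsep , ends))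
      saturate (no ¬unsep) with locate-start p 0ℚ 0≤B (u≤start 0≤w 0ℚ j) (<-≤-trans s<e (setEnd≤capTotal j))
      ... | k , starts = k , matched⇒M j k (edge-at-start j k k₀ starts edge , inj₂ (¬unsep , starts))

    boundedSplit : BoundedSplit x
    boundedSplit = M , record
      { sub   = λ j k Mjk → proj₁ (M⇒matched j k Mjk)
      ; uniqS = M-unique-bin
      ; uniqK = M-unique-set
      } , M-saturating

⟨$⟩ʳ-injective : ∀ {n} (π : Permutation n n) {i j} → π ⟨$⟩ʳ i ≡ π ⟨$⟩ʳ j → i ≡ j
⟨$⟩ʳ-injective π {i} {j} πi≡πj = trans (sym (Perm.inverseˡ π)) (trans (cong (π ⟨$⟩ˡ_) πi≡πj) (Perm.inverseˡ π))

⟨$⟩ˡ-injective : ∀ {n} (π : Permutation n n) {i j} → π ⟨$⟩ˡ i ≡ π ⟨$⟩ˡ j → i ≡ j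
⟨$⟩ˡ-injective π {i} {j} πi≡πj = trans (sym (Perm.inverseʳ π)) (trans (cong (π ⟨$⟩ʳ_) πi≡πj) (Perm.inverseʳ π))

boundedSplit-reindex : ∀ {m p} {x : Fin m → Fin p → ℚ} (σ : Permutation m m) (τ : Permutation p p) →
                       BoundedSplit x → BoundedSplit (λ j k → x (σ ⟨$⟩ˡ j) (τ ⟨$⟩ˡ k))
boundedSplit-reindex {m} {p} {x} σ τ (M , matching , saturating) = M′ , matching′ , saturating′
  where
  open IsMatching matching
  M′ : Fin m → Fin p → Bool
  M′ j k = M (σ ⟨$⟩ˡ j) (τ ⟨$⟩ˡ k)
  matching′ : IsMatching (λ j k → x (σ ⟨$⟩ˡ j) (τ ⟨$⟩ˡ k)) M′
  matching′ = record
    { sub   = λ j k → sub (σ ⟨$⟩ˡ j) (τ ⟨$⟩ˡ k)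
    ; uniqS = λ j k k′ M′jk M′jk′ → ⟨$⟩ˡ-injective τ (uniqS (σ ⟨$⟩ˡ j) (τ ⟨$⟩ˡ k) (τ ⟨$⟩ˡ k′) M′jk M′jk′)
    ; uniqK = λ j j′ k M′jk M′j′k → ⟨$⟩ˡ-injective σ (uniqK (σ ⟨$⟩ˡ j) (σ ⟨$⟩ˡ j′) (τ ⟨$⟩ˡ k) M′jk M′j′k)
    }
  saturating′ : Saturating (λ j k → x (σ ⟨$⟩ˡ j) (τ ⟨$⟩ˡ k)) M′
  saturating′ j (k , edge) with saturating (σ ⟨$⟩ˡ j) (τ ⟨$⟩ˡ k , edge)
  ... | k′ , Mjk′ = τ ⟨$⟩ʳ k′ , subst (λ v → M (σ ⟨$⟩ˡ j) v ≡ true) (sym (Perm.inverseˡ τ)) Mjk′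

-- Rounding an LP solution

module Rounding {n m p : ℕ} (I : Instance n m p) {xs : Fin m → Fin p → ℚ} {ys : Fin n → ℚ}
                (feasible : Feasible I xs ys) where
  open Instance I
  open Feasible feasible
  open Coverage I

  σ : Permutation m m
  σ = proj₁ (sortDescending m cost)

  τ : Permutation p p
  τ = proj₁ (sortDescending p cap)

  σ-sorted : SortedDescending cost σ
  σ-sorted = proj₂ (sortDescending m cost)

  τ-sorted : SortedDescending cap τ
  τ-sorted = proj₂ (sortDescending p cap)

  c : Fin m → ℚ
  c u = cost (σ ⟨$⟩ʳ u)

  0<c : ∀ u → 0ℚ < c u
  0<c u = cost-pos (σ ⟨$⟩ʳ u)

  B : Fin p → ℚ
  B v = cap (τ ⟨$⟩ʳ v)

  ic : Fin m → ℚ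
  ic u = inverse (c u) (0<c u)

  loads : (Fin m → ℚ) → Fin m → ℚ
  loads W j = W (σ ⟨$⟩ˡ j) * ic (σ ⟨$⟩ˡ j)

  Ψ : (Fin m → ℚ) → ℚ
  Ψ W = coverage (loads W)

  Ψ-exchange : ∀ W → (∀ u → W u ≤ c u) → ∀ {a b} → a ≢ b → ∀ {s t} → 0ℚ < s → 0ℚ < t →
               Ψ W ≤ Ψ (transfer W a b s) ⊎ Ψ W ≤ Ψ (transfer W a b (- t))
  Ψ-exchange W W≤c {a} {b} a≢b {s} {t} 0<s 0<t = Sum.map (along s) (along (- t)) (coverage-exchange 0<s 0<t)
    where
    d : Fin m → ℚ
    d j = exchange a b (σ ⟨$⟩ˡ j) * ic (σ ⟨$⟩ˡ j)
    d-at : ∀ u → d (σ ⟨$⟩ʳ u) ≡ exchange a b u * ic u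
    d-at u = cong (λ v → exchange a b v * ic v) (Perm.inverseˡ σ)
    d-rest : ∀ j → j ≢ σ ⟨$⟩ʳ a → j ≢ σ ⟨$⟩ʳ b → d j ≡ 0ℚ
    d-rest j j≢a j≢b = trans (cong (_* ic (σ ⟨$⟩ˡ j)) (exchange-elsewhere a≢b (away j≢a) (away j≢b)))
                             (*-zeroˡ (ic (σ ⟨$⟩ˡ j)))
      where
      away : ∀ {u} → j ≢ σ ⟨$⟩ʳ u → σ ⟨$⟩ˡ j ≢ u
      away j≢u σ⁻¹j≡u = j≢u (trans (sym (Perm.inverseʳ σ)) (cong (σ ⟨$⟩ʳ_) σ⁻¹j≡u))
    open Exchange (loads W) (λ j → ≤⇒*inverse≤1 (0<c (σ ⟨$⟩ˡ j)) (W≤c (σ ⟨$⟩ˡ j)))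
                  (λ σa≡σb → a≢b (⟨$⟩ʳ-injective σ σa≡σb)) d
                  (subst (0ℚ ≤_) (sym (trans (d-at a) (cong (_* ic a) (exchange-at-a a≢b))))
                         (*-nonNeg 0≤1 (<⇒≤ (0<inverse (0<c a)))))
                  (subst (_≤ 0ℚ) (sym (trans (d-at b) (trans (cong (_* ic b) (exchange-at-b a≢b))
                                                          (solve 1 (λ i → :- con 1ℚ :* i := :- i) refl (ic b)))))
                         (neg-antimono-≤ (<⇒≤ (0<inverse (0<c b)))))
                  d-rest
    along : ∀ r → coverage (loads W) ≤ coverage (shift r) → Ψ W ≤ Ψ (transfer W a b r)
    along r = subst (Ψ W ≤_) (coverage-cong (λ j → let u = σ ⟨$⟩ˡ j in
      solve 4 (λ w i r e → w :* i :+ r :* (e :* i) := (w :+ r :* e) :* i) refl (W u) (ic u) r (exchange a b u)))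

  open PipageRounding c (usable c B) Ψ Ψ-exchange using (Admissible; pipage-round)

  W₀ : Fin m → ℚ
  W₀ u = c u * load I xs (σ ⟨$⟩ʳ u)

  0≤load : ∀ j → 0ℚ ≤ load I xs j
  0≤load j = ∑-nonNeg p (λ k → x-lo j k)

  prefix-in-knapsack : ∀ q k → ∑ m (upTo q (λ u → c u * xs (σ ⟨$⟩ʳ u) k)) ≤ (if does (c q ≤? cap k) then cap k else 0ℚ)
  prefix-in-knapsack q k = by-cases (c q ≤? cap k)
    where
    terms : Fin m → ℚ
    terms = upTo q (λ u → c u * xs (σ ⟨$⟩ʳ u) k)
    by-cases : Dec (c q ≤ cap k) → ∑ m terms ≤ (if does (c q ≤? cap k) then cap k else 0ℚ)
    by-cases (yes cq≤cap) = subst (∑ m terms ≤_) (sym (if-yes (c q ≤? cap k) cq≤cap))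
      (≤-trans (∑-mono-≤ m (λ u → indicator≤ (does (u FinP.<? suc q)) (*-nonNeg (<⇒≤ (0<c u)) (x-lo _ k))))
               (subst (_≤ cap k) (∑-permute m (λ j → cost j * xs j k) σ) (knapsack k)))
    by-cases (no cq≰cap) = subst (∑ m terms ≤_) (sym (if-no (c q ≤? cap k) cq≰cap))
      (≤-reflexive (trans (∑-cong m (λ u → absent-term u (u FinP.<? suc q))) (∑-zero m)))
      where
      absent-term : ∀ u → Dec (u Fin.< suc q) → terms u ≡ 0ℚ
      absent-term u (no u≮1+q)       = if-no (u FinP.<? suc q) u≮1+q
      absent-term u (yes (s≤s u≤q)) = trans (if-yes (u FinP.<? suc q) (s≤s u≤q))
        (trans (cong (c u *_) (absent (σ ⟨$⟩ʳ u) k (<-≤-trans (≰⇒> cq≰cap) (σ-sorted u≤q)))) (*-zeroʳ (c u)))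

  W₀-prefix : ∀ q → end 0ℚ W₀ q ≤ usable c B q
  W₀-prefix q = begin
    end 0ℚ W₀ q                                                         ≡⟨ trans (end-as-∑ 0ℚ W₀ q) (+-identityˡ _) ⟩
    ∑ m (upTo q W₀)                                                     ≡⟨ ∑-cong m per-set ⟩
    ∑ m (λ u → ∑ p (λ k → upTo q (λ u → c u * xs (σ ⟨$⟩ʳ u) k) u))       ≡⟨ ∑-comm m p _ ⟩
    ∑ p (λ k → ∑ m (upTo q (λ u → c u * xs (σ ⟨$⟩ʳ u) k)))              ≤⟨ ∑-mono-≤ p (prefix-in-knapsack q) ⟩
    ∑ p (λ k → if does (c q ≤? cap k) then cap k else 0ℚ)               ≡⟨ ∑-permute p _ τ ⟩
    usable c B q                                                        ∎
    where
    open ≤-Reasoning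
    per-set : ∀ u → upTo q W₀ u ≡ ∑ p (λ k → upTo q (λ u → c u * xs (σ ⟨$⟩ʳ u) k) u)
    per-set u = trans (cong (λ v → if does (u FinP.<? suc q) then v else 0ℚ)
                            (sym (*-distribˡ-∑ p (c u) (xs (σ ⟨$⟩ʳ u)))))
                      (if-∑ p (does (u FinP.<? suc q)) _)

  W₀-admissible : Admissible W₀
  W₀-admissible = record
    { nonNeg  = λ u → *-nonNeg (<⇒≤ (0<c u)) (0≤load _)
    ; ≤cap    = λ u → subst (c u * load I xs (σ ⟨$⟩ʳ u) ≤_) (*-identityʳ (c u))
                        (*-monoˡ-≤-nonNeg (c u) {{nonNegative (<⇒≤ (0<c u))}} (once _))
    ; prefix≤ = W₀-prefix
    }

  rounded : ∃[ W ] (Admissible W × Ψ W₀ ≤ Ψ W × Separated c (usable c B) W)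
  rounded = pipage-round W₀ W₀-admissible

  W : Fin m → ℚ
  W = proj₁ rounded

  W-admissible : Admissible W
  W-admissible = proj₁ (proj₂ rounded)

  Ψ-improved : Ψ W₀ ≤ Ψ W
  Ψ-improved = proj₁ (proj₂ (proj₂ rounded))

  W-separated : Separated c (usable c B) W
  W-separated = proj₂ (proj₂ (proj₂ rounded))

  open Admissible W-admissible renaming (nonNeg to 0≤W; ≤cap to W≤c; prefix≤ to W-prefix)
  open Layout c 0<c B (λ v → cap-pos (τ ⟨$⟩ʳ v)) τ-sorted W 0≤W W≤c W-prefix
    using (x; ∑-x; x-absent; ∑-cost-x; share≤1; 0≤x; x≤1; module Matching)
  open Matching W-separated using (boundedSplit)

  x′ : Fin m → Fin p → ℚ
  x′ j k = x (σ ⟨$⟩ˡ j) (τ ⟨$⟩ˡ k)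

  load-x′ : ∀ j → load I x′ j ≡ loads W j
  load-x′ j = trans (∑-permute p (x′ j) τ)
                    (trans (∑-cong p (λ v → cong (x (σ ⟨$⟩ˡ j)) (Perm.inverseˡ τ))) (∑-x (σ ⟨$⟩ˡ j)))

  loads-W₀ : ∀ j → loads W₀ j ≡ load I xs j
  loads-W₀ j = begin
    (c u * load I xs (σ ⟨$⟩ʳ u)) * ic u  ≡⟨ solve 3 (λ c l i → (c :* l) :* i := l :* (c :* i)) refl
                                                     (c u) (load I xs (σ ⟨$⟩ʳ u)) (ic u) ⟩
    load I xs (σ ⟨$⟩ʳ u) * (c u * ic u)  ≡⟨ cong (load I xs (σ ⟨$⟩ʳ u) *_) (*-inverse (0<c u)) ⟩
    load I xs (σ ⟨$⟩ʳ u) * 1ℚ            ≡⟨ *-identityʳ _ ⟩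
    load I xs (σ ⟨$⟩ʳ u)                 ≡⟨ cong (load I xs) (Perm.inverseʳ σ) ⟩
    load I xs j                          ∎
    where
    open ≡-Reasoning
    u : Fin m
    u = σ ⟨$⟩ˡ j

  cost-σ : ∀ j → c (σ ⟨$⟩ˡ j) ≡ cost j
  cost-σ j = cong cost (Perm.inverseʳ σ)

  cap-τ : ∀ k → B (τ ⟨$⟩ˡ k) ≡ cap k
  cap-τ k = cong cap (Perm.inverseʳ τ)

  x′-absent : ∀ j k → cap k < cost j → x′ j k ≡ 0ℚ
  x′-absent j k cap<cost = x-absent (σ ⟨$⟩ˡ j) (τ ⟨$⟩ˡ k) (subst₂ _<_ (sym (cap-τ k)) (sym (cost-σ j)) cap<cost)

  x′-knapsack : ∀ k → ∑ m (λ j → cost j * x′ j k) ≤ cap k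
  x′-knapsack k = subst₂ _≤_ reindex (cap-τ k) (∑-cost-x (τ ⟨$⟩ˡ k))
    where
    reindex : ∑ m (λ u → c u * x u (τ ⟨$⟩ˡ k)) ≡ ∑ m (λ j → cost j * x′ j k)
    reindex = sym (trans (∑-permute m (λ j → cost j * x′ j k) σ)
                         (∑-cong m (λ u → cong (λ v → c u * x v (τ ⟨$⟩ˡ k)) (Perm.inverseˡ σ))))

  x′-once : ∀ j → load I x′ j ≤ 1ℚ
  x′-once j = subst (_≤ 1ℚ) (sym (load-x′ j)) (share≤1 (σ ⟨$⟩ˡ j))

  0≤load-x′ : ∀ j → 0ℚ ≤ load I x′ j
  0≤load-x′ j = ∑-nonNeg p (λ k → 0≤x (σ ⟨$⟩ˡ j) (τ ⟨$⟩ˡ k))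

  x′-feasible : Feasible I x′ (λ _ → 0ℚ)
  x′-feasible = record
    { absent   = x′-absent
    ; knapsack = x′-knapsack
    ; once     = x′-once
    ; cover    = λ i → ∑-nonNeg m (λ j → indicator-nonNeg (inSet j i) (0≤load-x′ j))
    ; x-lo     = λ j k → 0≤x (σ ⟨$⟩ˡ j) (τ ⟨$⟩ˡ k)
    ; x-hi     = λ j k → x≤1 (σ ⟨$⟩ˡ j) (τ ⟨$⟩ˡ k)
    ; y-lo     = λ _ → ≤-refl
    ; y-hi     = λ _ → 0≤1
    }

  x′-boundedSplit : BoundedSplit x′
  x′-boundedSplit = boundedSplit-reindex σ τ boundedSplit

  F-improved : F I xs ≤ F I x′
  F-improved = subst₂ _≤_ (coverage-cong loads-W₀) (coverage-cong (λ j → sym (load-x′ j))) Ψ-improved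

theorem1 : {n m p : ℕ} (I : Instance n m p)
    (xs : Fin m → Fin p → ℚ) (ys : Fin n → ℚ) → Optimal I xs ys →
    ∃[ x ] ∃[ y ] (Feasible I x y × BoundedSplit x × F I xs ≤ F I x)
theorem1 I xs ys (feasible , _) = x′ , (λ _ → 0ℚ) , x′-feasible , x′-boundedSplit , F-improved
  where open Rounding I feasible
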